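{- Let $D\ge 3$. The sets $X_{i,j,t}=\{(x,y,z)\in X\times X\times X:\partial(x,y,z)=(i,j,t)\}$, $(i,j,t)\in\mathcal I$, are the orbits of $X\times X\times X$ under the (diagonal) action of the automorphism group $\mathrm{Aut}(X)$ of $\square_{2D}$.
   Context: Let $S=\{1,\dots,2D\}$, $X$ the set of unordered pairs $\{u,u'\}$ of subsets of $S$ with $u\cap u'=\emptyset$, $u\cup u'=S$. The folded cube $\square_{2D}$ is the graph on $X$ with distance $\partial(x,y)=\min\{|x_1\triangle y_1|,|x_1\triangle y_2|\}$ for $x=\{x_1,x_2\},y=\{y_1,y_2\}$ (adjacent iff distance $1$). For $x,y,z\in X$ define $\partial(x,y,z)=(i,j,t)$ as follows: $i=\partial(x,y)$, $j=\partial(x,z)$; label the parts $x=(x_1,x_2)$, $y=(y_1,y_2)$, $z=(z_1,z_2)$ so that $|x_1\triangle y_1|=i$ and $|x_1\triangle z_1|=j$; then $t=|(x_1\triangle y_1)\cap(x_1\triangle z_1)|$ if $i,j\le D-1$; $t=\max\{|(x_1\triangle y_1)\cap(x_1\triangle z_1)|,|(x_1\triangle y_2)\cap(x_1\triangle z_1)|\}$ if $i=D$, $j\le D-1$; $t=\max\{|(x_1\triangle y_1)\cap(x_1\triangle z_1)|,|(x_1\triangle y_1)\cap(x_1\triangle z_2)|\}$ if $i\le D-1$, $j=D$ or if $i=j=D$. Let $\mathcal I=\{(i,j,t): 0\le t\le i,j\le D,\ i+j-t\le 2D-2,\ t\ge\lfloor (j+1)/2\rfloor \text{ if } i=D,\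 t\ge\lfloor (i+1)/2\rfloor\text{ if } j=D\}$. -}

module Defs where

open import Data.Bool using (Bool; true; false; not; T; if_then_else_)
open import Data.Nat using (ℕ; zero; suc; _+_; _*_; _∸_; _≤_; _<_; _≤ᵇ_; _⊔_; _⊓_; ⌊_/2⌋)
open import Data.Vec using (Vec; []; _∷_)
open import Data.Fin.Subset using (Subset; ∁; _∩_; _∪_; _─_; ∣_∣)
open import Data.Product using (Σ; Σ-syntax; ∃; ∃-syntax; _×_; _,_; proj₁)
open import Relation.Binary.PropositionalEquality using (_≡_)
open import Function.Bundles using (_⇔_)
open import Function.Definitions using (Bijective)

-- S = {1,…,2D} is represented by Fin (2 * D); element 1 of S is Fin index 0.

_△_ : ∀ {n} → Subset n → Subset n → Subset n
p △ q = (p ─ q) ∪ (q ─ p)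

firstOut : ∀ {n} → Subset n → Bool
firstOut []      = true
firstOut (b ∷ _) = not b

-- A vertex {u , S∖u} of the folded cube is represented canonically by the
-- part u that does not contain the element 1 of S (the other part is ∁ u).
record X (D : ℕ) : Set where
  constructor vertex
  field
    part   : Subset (2 * D)        -- the canonical labelled part x₁ (x₂ = ∁ x₁)
    1∉part : T (firstOut part)

open X public

dist : ∀ {D} → X D → X D → ℕ
dist x y = ∣ part x △ part y ∣ ⊓ ∣ part x △ ∁ (part y) ∣

Adjacent : ∀ {D} → X D → X D → Set
Adjacent x y = dist x y ≡ 1

IsAut : ∀ {D} → (X D → X D) → Set
IsAut {D} f = Bijective _≡_ _≡_ f × (∀ x y → Adjacent x y ⇔ Adjacent (f x) (f y))

Aut : ℕ → Set
Aut D = Σ[ f ∈ (X D → X D) ] IsAut f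

-- labelling y₁ of y chosen with |x₁ △ y₁| = ∂(x,y)
-- (if |x₁ △ part y| ≤ D, take y₁ = part y, else y₁ = ∁ (part y))
label : ∀ {D} → X D → X D → Subset (2 * D)
label {D} x y =
  if ∣ part x △ part y ∣ ≤ᵇ D then part y else ∁ (part y)

dist3 : ∀ {D} → X D → X D → X D → ℕ × ℕ × ℕ
dist3 {D} x y z = i , j , t
  where
  i = dist x y
  j = dist x z
  x₁ = part x
  y₁ = label x y
  y₂ = ∁ y₁
  z₁ = label x z
  z₂ = ∁ z₁
  t : ℕ
  t = if suc i ≤ᵇ D
      then (if suc j ≤ᵇ D
            then ∣ (x₁ △ y₁) ∩ (x₁ △ z₁) ∣
            else ∣ (x₁ △ y₁) ∩ (x₁ △ z₁) ∣ ⊔ ∣ (x₁ △ y₁) ∩ (x₁ △ z₂) ∣)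
      else (if suc j ≤ᵇ D
            then ∣ (x₁ △ y₁) ∩ (x₁ △ z₁) ∣ ⊔ ∣ (x₁ △ y₂) ∩ (x₁ △ z₁) ∣
            else ∣ (x₁ △ y₁) ∩ (x₁ △ z₁) ∣ ⊔ ∣ (x₁ △ y₁) ∩ (x₁ △ z₂) ∣)

InI : ℕ → ℕ × ℕ × ℕ → Set
InI D (i , j , t) =
  t ≤ i × t ≤ j × i ≤ D × j ≤ D
  × i + j ≤ (2 * D ∸ 2) + t
  × (i ≡ D → ⌊ suc j /2⌋ ≤ t)
  × (j ≡ D → ⌊ suc i /2⌋ ≤ t)

Triple : ℕ → Set
Triple D = X D × X D × X D

dist3T : ∀ {D} → Triple D → ℕ × ℕ × ℕ
dist3T (x , y , z) = dist3 x y z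

act : ∀ {D} → Aut D → Triple D → Triple D
act (f , _) (x , y , z) = f x , f y , f z

SameOrbit : ∀ {D} → Triple D → Triple D → Set
SameOrbit {D} a b = Σ[ σ ∈ Aut D ] act σ a ≡ b

module Submission where

-- A vertex is a bipartition {p, ∁ p} of S, and distances are folded sizes
-- ∥ w ∥ = min(|w|, |∁ w|) of symmetric differences.  For a triple (x, y, z)
-- the labelled differences A = x₁ △ y₁ and B = x₁ △ z₁ have at most D points
-- and ∂(x,y,z) is a function (its shape) of the profile of cell sizes
-- (|A ∩ B|, |A ∖ B|, |B ∖ A|, |∁A ∩ ∁B|).  The development:
--  * arithmetic of the formula for t, organised by its four regimes (TCase):
--    shapes of admissible profiles lie in 𝓘 and every element of 𝓘 is such a
--    shape; this gives the first two parts of the theorem;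
--  * the metric of the folded cube: geodesic steps, so adjacency-preserving
--    maps are non-expansive and automorphisms are isometries;
--  * t is the largest |A' ∩ B'| over all labellings (representatives A' of
--    x △ y and B' of x △ z with at most D points), and metrically the largest
--    distance from x of a vertex on common geodesics from x to y and to z;
--    hence automorphisms preserve ∂;
--  * conversely, optimal labellings of two triples with the same ∂ have the
--    same profile, so a permutation π of S aligns them, and the automorphism
--    p ↦ π(p △ x) △ x' carries one triple onto the other.

open import Defs
import Algebra.Lattice.Properties.BooleanAlgebra as BooleanAlgebraProperties
open import Data.Bool using (Bool; true; false; not; T; if_then_else_; _∧_; _∨_)
open import Data.Bool.Properties using (T-≡; T-irrelevant)
open import Data.Empty using (⊥-elim)
open import Data.Fin using (Fin; zero; suc)
open import Data.Fin.Permutation using (Permutation; _⟨$⟩ʳ_; inverseˡ; inverseʳ; flip; transpose; lift₀; _∘ₚ_) renaming (id to idₚ)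
open import Data.Fin.Subset using (Subset; ∁; _∩_; _∪_; ∣_∣; ⊥)
open import Data.Fin.Subset.Properties using (∪-∩-booleanAlgebra; ∩-comm; ∣∁p∣≡n∸∣p∣; ∣p∣≤n; ∣⊥∣≡0; ∣p∩q∣≤∣p∣; ∣p∩q∣≤∣q∣)
open import Data.Nat using (ℕ; zero; suc; _+_; _*_; _∸_; _≤_; _<_; _≤ᵇ_; _⊔_; _⊓_; z≤n; s≤s; s≤s⁻¹; ⌊_/2⌋)
open import Data.Nat.Properties
open import Algebra.Properties.CommutativeMonoid.Sum +-0-commutativeMonoid using (sum; sum-permute; sum-cong-≗)
open import Data.Nat.Tactic.RingSolver using (solve-∀)
open import Data.Product using (Σ; Σ-syntax; ∃; _×_; _,_; proj₁; proj₂)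
open import Data.Sum using (_⊎_; inj₁; inj₂)
open import Data.Vec using ([]; _∷_; lookup; tabulate; zipWith; map; tail)
open import Data.Vec.Properties using (lookup∘tabulate; tabulate∘lookup; tabulate-cong; lookup-zipWith; lookup-map; lookup-replicate)
open import Function.Bundles using (_⇔_; Equivalence; mk⇔)
open import Relation.Binary.PropositionalEquality

private variable n : ℕ

-- Symmetric difference is the xor of the Boolean algebra of subsets, so
-- (Subset n, △, ⊥) is an elementary abelian 2-group; the library's
-- xor-ring construction provides its laws.
△-def : (p q : Subset n) → p △ q ≡ (p ∪ q) ∩ ∁ (p ∩ q)
△-def [] [] = refl
△-def (true ∷ p) (true ∷ q) = cong (false ∷_) (△-def p q)
△-def (true ∷ p) (false ∷ q) = cong (true ∷_) (△-def p q)
△-def (false ∷ p) (true ∷ q) = cong (true ∷_) (△-def p q)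
△-def (false ∷ p) (false ∷ q) = cong (false ∷_) (△-def p q)

module Boolean {n : ℕ} = BooleanAlgebraProperties (∪-∩-booleanAlgebra n)
module Xor {n : ℕ} = Boolean.XorRing {n} _△_ △-def

open Boolean using (¬-involutive)
open Xor using (⊕-comm; ⊕-assoc; ⊕-identityˡ; ⊕-identityʳ; ⊕-inverseʳ)

△-∁ʳ : (p q : Subset n) → p △ ∁ q ≡ ∁ (p △ q)
△-∁ʳ p q = sym (Xor.¬-distribʳ-⊕ p q)

△-∁ˡ : (p q : Subset n) → ∁ p △ q ≡ ∁ (p △ q)
△-∁ˡ p q = sym (Xor.¬-distribˡ-⊕ p q)

△-cancelʳ : (p q : Subset n) → (p △ q) △ q ≡ p
△-cancelʳ p q = begin
  (p △ q) △ q ≡⟨ ⊕-assoc p q q ⟩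
  p △ (q △ q) ≡⟨ cong (p △_) (⊕-inverseʳ q) ⟩
  p △ ⊥       ≡⟨ ⊕-identityʳ p ⟩
  p           ∎
  where open ≡-Reasoning

△-cancelˡ : (p q : Subset n) → p △ (p △ q) ≡ q
△-cancelˡ p q = trans (⊕-comm p (p △ q)) (trans (cong (_△ p) (⊕-comm p q)) (△-cancelʳ q p))

△-translate : (p q r : Subset n) → (p △ r) △ (q △ r) ≡ p △ q
△-translate p q r = begin
  (p △ r) △ (q △ r) ≡⟨ cong ((p △ r) △_) (⊕-comm q r) ⟩
  (p △ r) △ (r △ q) ≡⟨ ⊕-assoc p r (r △ q) ⟩
  p △ (r △ (r △ q)) ≡⟨ cong (p △_) (△-cancelˡ r q) ⟩
  p △ q             ∎
  where open ≡-Reasoning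

∣p∣+∣∁p∣ : (p : Subset n) → ∣ p ∣ + ∣ ∁ p ∣ ≡ n
∣p∣+∣∁p∣ p = trans (cong (∣ p ∣ +_) (∣∁p∣≡n∸∣p∣ p)) (m+[n∸m]≡n (∣p∣≤n p))

∣p∣-split : (p q : Subset n) → ∣ p ∣ ≡ ∣ p ∩ q ∣ + ∣ p ∩ ∁ q ∣
∣p∣-split [] [] = refl
∣p∣-split (true ∷ p) (true ∷ q) = cong suc (∣p∣-split p q)
∣p∣-split (true ∷ p) (false ∷ q) = trans (cong suc (∣p∣-split p q)) (sym (+-suc _ _))
∣p∣-split (false ∷ p) (true ∷ q) = ∣p∣-split p q
∣p∣-split (false ∷ p) (false ∷ q) = ∣p∣-split p q

∣q∣-split : (p q : Subset n) → ∣ q ∣ ≡ ∣ p ∩ q ∣ + ∣ ∁ p ∩ q ∣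
∣q∣-split p q = trans (∣p∣-split q p) (cong₂ _+_ (cong ∣_∣ (∩-comm q p)) (cong ∣_∣ (∩-comm q (∁ p))))

∣p△q∣ : (p q : Subset n) → ∣ p △ q ∣ ≡ ∣ p ∩ ∁ q ∣ + ∣ ∁ p ∩ q ∣
∣p△q∣ [] [] = refl
∣p△q∣ (true ∷ p) (true ∷ q) = ∣p△q∣ p q
∣p△q∣ (true ∷ p) (false ∷ q) = cong suc (∣p△q∣ p q)
∣p△q∣ (false ∷ p) (true ∷ q) = trans (cong suc (∣p△q∣ p q)) (sym (+-suc _ _))
∣p△q∣ (false ∷ p) (false ∷ q) = ∣p△q∣ p q

-- The folded size of w: the size of the smaller of the two parts {w, ∁ w}.
-- Distances in the folded cube are folded sizes of symmetric differences.
∥_∥ : Subset n → ℕ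
∥ w ∥ = ∣ w ∣ ⊓ ∣ ∁ w ∣

∥∁w∥ : (w : Subset n) → ∥ ∁ w ∥ ≡ ∥ w ∥
∥∁w∥ w = trans (cong (∣ ∁ w ∣ ⊓_) (cong ∣_∣ (¬-involutive w))) (⊓-comm _ _)

dist≡∥△∥ : ∀ {D} (x y : X D) → dist x y ≡ ∥ part x △ part y ∥
dist≡∥△∥ x y = cong (∣ part x △ part y ∣ ⊓_) (cong ∣_∣ (△-∁ʳ (part x) (part y)))

infix 4 _≈ₛ_
_≈ₛ_ : Subset n → Subset n → Set
p ≈ₛ q = p ≡ q ⊎ p ≡ ∁ q

≈ₛ-sym : {p q : Subset n} → p ≈ₛ q → q ≈ₛ p
≈ₛ-sym (inj₁ e) = inj₁ (sym e)
≈ₛ-sym {q = q} (inj₂ e) = inj₂ (trans (sym (¬-involutive q)) (cong ∁ (sym e)))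

≈ₛ-trans : {p q r : Subset n} → p ≈ₛ q → q ≈ₛ r → p ≈ₛ r
≈ₛ-trans (inj₁ refl) h = h
≈ₛ-trans (inj₂ refl) (inj₁ refl) = inj₂ refl
≈ₛ-trans {r = r} (inj₂ refl) (inj₂ refl) = inj₁ (¬-involutive r)

≈ₛ-△ʳ : {p q : Subset n} (r : Subset n) → p ≈ₛ q → (p △ r) ≈ₛ (q △ r)
≈ₛ-△ʳ r (inj₁ refl) = inj₁ refl
≈ₛ-△ʳ {q = q} r (inj₂ refl) = inj₂ (△-∁ˡ q r)

≈ₛ-△ˡ : {p q : Subset n} (r : Subset n) → p ≈ₛ q → (r △ p) ≈ₛ (r △ q)
≈ₛ-△ˡ r (inj₁ refl) = inj₁ refl
≈ₛ-△ˡ {q = q} r (inj₂ refl) = inj₂ (△-∁ʳ r q)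

∥∥-≈ₛ : {p q : Subset n} → p ≈ₛ q → ∥ p ∥ ≡ ∥ q ∥
∥∥-≈ₛ (inj₁ refl) = refl
∥∥-≈ₛ {q = q} (inj₂ refl) = ∥∁w∥ q

2*D≡D+D : ∀ D → 2 * D ≡ D + D
2*D≡D+D D = cong (D +_) (+-identityʳ D)

∣w∣+∣∁w∣≡D+D : ∀ {D} (w : Subset (2 * D)) → ∣ w ∣ + ∣ ∁ w ∣ ≡ D + D
∣w∣+∣∁w∣≡D+D {D} w = trans (∣p∣+∣∁p∣ w) (2*D≡D+D D)

∥w∥≡∣w∣ : ∀ {D} (w : Subset (2 * D)) → ∣ w ∣ ≤ D → ∥ w ∥ ≡ ∣ w ∣
∥w∥≡∣w∣ {D} w w≤D = m≤n⇒m⊓n≡m (≤-trans w≤D (+-cancelˡ-≤ D D ∣ ∁ w ∣ D+D≤D+∣∁w∣))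
  where
  D+D≤D+∣∁w∣ : D + D ≤ D + ∣ ∁ w ∣
  D+D≤D+∣∁w∣ = subst (_≤ D + ∣ ∁ w ∣) (∣w∣+∣∁w∣≡D+D {D} w) (+-monoˡ-≤ ∣ ∁ w ∣ w≤D)

smallSide : ∀ D → Subset (2 * D) → Subset (2 * D)
smallSide D w = if ∣ w ∣ ≤ᵇ D then w else ∁ w

record SmallRep (D : ℕ) (w w' : Subset (2 * D)) : Set where
  field
    same  : w' ≈ₛ w
    size  : ∣ w' ∣ ≡ ∥ w ∥
    small : ∣ w' ∣ ≤ D

∣w∣>D⇒∣∁w∣<D : ∀ {D} (w : Subset (2 * D)) → D < ∣ w ∣ → ∣ ∁ w ∣ < D
∣w∣>D⇒∣∁w∣<D {D} w D<∣w∣ = +-cancelˡ-< D ∣ ∁ w ∣ D (subst (D + ∣ ∁ w ∣ <_) (∣w∣+∣∁w∣≡D+D {D} w) (+-monoˡ-< ∣ ∁ w ∣ D<∣w∣))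

smallSide-rep : ∀ D (w : Subset (2 * D)) → SmallRep D w (smallSide D w)
smallSide-rep D w with ∣ w ∣ ≤ᵇ D in test
... | true  = record { same = inj₁ refl ; size = sym (∥w∥≡∣w∣ w w≤D) ; small = w≤D }
  where w≤D = ≤ᵇ⇒≤ ∣ w ∣ D (subst T (sym test) _)
... | false = record { same = inj₂ refl ; size = trans (sym (∥w∥≡∣w∣ (∁ w) ∁w≤D)) (∥∁w∥ w) ; small = ∁w≤D }
  where
  ∁w≤D : ∣ ∁ w ∣ ≤ D
  ∁w≤D = <⇒≤ (∣w∣>D⇒∣∁w∣<D w (≰⇒> (λ w≤D → subst T test (≤⇒≤ᵇ w≤D))))

-- The formula defining t in ∂(x,y,z), as a function of D, i = ∂(x,y),
-- j = ∂(x,z) and the sizes a = |A ∩ B|, b = |A ∖ B|, c = |B ∖ A| of the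
-- labelled differences A = x₁ △ y₁, B = x₁ △ z₁.
tFormula : ℕ → ℕ → ℕ → ℕ → ℕ → ℕ → ℕ
tFormula D i j a b c =
  if suc i ≤ᵇ D
  then (if suc j ≤ᵇ D then a else a ⊔ b)
  else (if suc j ≤ᵇ D then a ⊔ c else a ⊔ b)

data TCase (D i j a b c : ℕ) : ℕ → Set where
  inner   : i < D → j < D → TCase D i j a b c a
  on-j    : i < D → j ≡ D → TCase D i j a b c (a ⊔ b)
  on-i    : i ≡ D → j < D → TCase D i j a b c (a ⊔ c)
  on-both : i ≡ D → j ≡ D → TCase D i j a b c (a ⊔ b)

<ᵇ-true : ∀ {m D} → (suc m ≤ᵇ D) ≡ true → m < D
<ᵇ-true {m} {D} test = ≤ᵇ⇒≤ (suc m) D (subst T (sym test) _)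

<ᵇ-false : ∀ {m D} → m ≤ D → (suc m ≤ᵇ D) ≡ false → m ≡ D
<ᵇ-false m≤D test = ≤-antisym m≤D (≮⇒≥ (λ m<D → subst T test (≤⇒≤ᵇ m<D)))

tCase : ∀ {D i j} a b c → i ≤ D → j ≤ D → TCase D i j a b c (tFormula D i j a b c)
tCase {D} {i} {j} a b c i≤D j≤D with suc i ≤ᵇ D in ti | suc j ≤ᵇ D in tj
... | true  | true  = inner (<ᵇ-true ti) (<ᵇ-true tj)
... | true  | false = on-j (<ᵇ-true ti) (<ᵇ-false j≤D tj)
... | false | true  = on-i (<ᵇ-false i≤D ti) (<ᵇ-true tj)
... | false | false = on-both (<ᵇ-false i≤D ti) (<ᵇ-false j≤D tj)

halve-≤ : ∀ {m n} → m + m ≤ n + n → m ≤ n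
halve-≤ h = ≮⇒≥ (λ n<m → <⇒≱ (+-mono-< n<m n<m) h)

+2≤ : ∀ {m D} → 3 ≤ D → m + m < D → m + 2 ≤ D
+2≤ {m} {D} D≥3 2m<D = halve-≤ (subst (_≤ D + D) (eq m) (+-mono-≤ 2m<D D≥3))
  where
  eq : ∀ m → suc (m + m) + 3 ≡ (m + 2) + (m + 2)
  eq = solve-∀

2D∸2+2 : ∀ D → 1 ≤ D → (2 * D ∸ 2) + 2 ≡ D + D
2D∸2+2 D D≥1 = trans (m∸n+n≡m (*-monoʳ-≤ 2 D≥1)) (2*D≡D+D D)

-- the shape in which the bound i + j ≤ (2D − 2) + t gets proved
≤2D∸2+ : ∀ {D} m t → 1 ≤ D → m + 2 ≤ (D + D) + t → m ≤ (2 * D ∸ 2) + t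
≤2D∸2+ {D} m t D≥1 h = +-cancelʳ-≤ 2 m ((2 * D ∸ 2) + t) (subst (m + 2 ≤_) eq h)
  where
  eq : (D + D) + t ≡ ((2 * D ∸ 2) + t) + 2
  eq = begin
    (D + D) + t             ≡⟨ cong (_+ t) (2D∸2+2 D D≥1) ⟨
    ((2 * D ∸ 2) + 2) + t   ≡⟨ +-assoc (2 * D ∸ 2) 2 t ⟩
    (2 * D ∸ 2) + (2 + t)   ≡⟨ cong ((2 * D ∸ 2) +_) (+-comm 2 t) ⟩
    (2 * D ∸ 2) + (t + 2)   ≡⟨ +-assoc (2 * D ∸ 2) t 2 ⟨
    ((2 * D ∸ 2) + t) + 2   ∎
    where open ≡-Reasoning

⌊suc[m+n]/2⌋≤m⊔n : ∀ m n → ⌊ suc (m + n) /2⌋ ≤ m ⊔ n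
⌊suc[m+n]/2⌋≤m⊔n m n = subst (⌊ suc (m + n) /2⌋ ≤_) (sym (n≡⌈n+n/2⌉ (m ⊔ n)))
  (⌊n/2⌋-mono (s≤s (+-mono-≤ (m≤m⊔n m n) (m≤n⊔m m n))))

InI-swap : ∀ {D i j t} → InI D (i , j , t) → InI D (j , i , t)
InI-swap {D} {i} {j} {t} (t≤i , t≤j , i≤D , j≤D , i+j≤ , at-i , at-j) =
  t≤j , t≤i , j≤D , i≤D , subst (_≤ (2 * D ∸ 2) + t) (+-comm i j) i+j≤ , at-j , at-i

inner-InI : ∀ {D a b c} → a + b < D → a + c < D → InI D (a + b , a + c , a)
inner-InI {D} {a} {b} {c} i<D j<D =
  m≤m+n a b , m≤m+n a c , <⇒≤ i<D , <⇒≤ j<D , i+j≤ ,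
  (λ i≡D → ⊥-elim (<-irrefl i≡D i<D)) , (λ j≡D → ⊥-elim (<-irrefl j≡D j<D))
  where
  i+j≤ : (a + b) + (a + c) ≤ (2 * D ∸ 2) + a
  i+j≤ = ≤2D∸2+ _ a (≤-trans (s≤s z≤n) i<D)
    (subst (_≤ (D + D) + a) (eq a b c) (≤-trans (+-mono-≤ i<D j<D) (m≤m+n (D + D) a)))
    where
    eq : ∀ a b c → suc (a + b) + suc (a + c) ≡ (a + b) + (a + c) + 2
    eq = solve-∀

on-j-sum-ordered : ∀ {D} a b → 3 ≤ D → a ≤ b → a + b < D → (a + b) + D ≤ (2 * D ∸ 2) + b
on-j-sum-ordered {D} a b D≥3 a≤b i<D = ≤2D∸2+ _ b (≤-trans (s≤s z≤n) D≥3)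
  (subst (_≤ (D + D) + b) (eq a b D) (+-monoˡ-≤ b (+-monoˡ-≤ D a+2≤D)))
  where
  a+2≤D : a + 2 ≤ D
  a+2≤D = +2≤ D≥3 (≤-<-trans (+-monoʳ-≤ a a≤b) i<D)
  eq : ∀ a b D → (a + 2) + D + b ≡ (a + b) + D + 2
  eq = solve-∀

on-j-sum : ∀ {D} a b → 3 ≤ D → a + b < D → (a + b) + D ≤ (2 * D ∸ 2) + (a ⊔ b)
on-j-sum {D} a b D≥3 i<D with ≤-total a b
... | inj₁ a≤b = subst (λ t → (a + b) + D ≤ (2 * D ∸ 2) + t) (sym (m≤n⇒m⊔n≡n a≤b))
  (on-j-sum-ordered a b D≥3 a≤b i<D)
... | inj₂ b≤a = subst₂ (λ s t → s + D ≤ (2 * D ∸ 2) + t) (+-comm b a) (sym (m≥n⇒m⊔n≡m b≤a))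
  (on-j-sum-ordered b a D≥3 b≤a (subst (_< D) (+-comm a b) i<D))

on-j-InI : ∀ {D a b c} → 3 ≤ D → a + b < D → a + c ≡ D → InI D (a + b , a + c , a ⊔ b)
on-j-InI {D} {a} {b} {c} D≥3 i<D j≡D =
  m⊔n≤m+n a b , ⊔-lub (m≤m+n a c) b≤j , <⇒≤ i<D , ≤-reflexive j≡D ,
  subst (λ j → (a + b) + j ≤ (2 * D ∸ 2) + (a ⊔ b)) (sym j≡D) (on-j-sum a b D≥3 i<D) ,
  (λ i≡D → ⊥-elim (<-irrefl i≡D i<D)) , (λ _ → ⌊suc[m+n]/2⌋≤m⊔n a b)
  where
  b≤j : b ≤ a + c
  b≤j = ≤-trans (m≤n+m b a) (≤-trans (<⇒≤ i<D) (≤-reflexive (sym j≡D)))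

on-both-InI : ∀ {D a b c} → 3 ≤ D → a + b ≡ D → a + c ≡ D → InI D (a + b , a + c , a ⊔ b)
on-both-InI {D} {a} {b} {c} D≥3 i≡D j≡D =
  m⊔n≤m+n a b , subst (a ⊔ b ≤_) (trans i≡D (sym j≡D)) (m⊔n≤m+n a b) ,
  ≤-reflexive i≡D , ≤-reflexive j≡D , i+j≤ ,
  (λ _ → subst (λ j → ⌊ suc j /2⌋ ≤ a ⊔ b) (trans i≡D (sym j≡D)) (⌊suc[m+n]/2⌋≤m⊔n a b)) ,
  (λ _ → ⌊suc[m+n]/2⌋≤m⊔n a b)
  where
  2≤max : 2 ≤ a ⊔ b
  2≤max = ≮⇒≥ λ max<2 → <⇒≱ (subst (3 ≤_) (sym i≡D) D≥3)
    (+-mono-≤ (s≤s⁻¹ (≤-trans (s≤s (m≤m⊔n a b)) max<2)) (s≤s⁻¹ (≤-trans (s≤s (m≤n⊔m a b)) max<2)))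
  i+j≤ : (a + b) + (a + c) ≤ (2 * D ∸ 2) + (a ⊔ b)
  i+j≤ = ≤2D∸2+ _ _ (≤-trans (s≤s z≤n) D≥3)
    (subst₂ (λ i j → i + j + 2 ≤ (D + D) + (a ⊔ b)) (sym i≡D) (sym j≡D)
      (+-monoʳ-≤ (D + D) 2≤max))

tCase-InI : ∀ {D a b c t} → 3 ≤ D → TCase D (a + b) (a + c) a b c t → InI D (a + b , a + c , t)
tCase-InI {a = a} {b} {c} D≥3 (inner i<D j<D) = inner-InI {a = a} {b} {c} i<D j<D
tCase-InI {a = a} {b} {c} D≥3 (on-j i<D j≡D) = on-j-InI {a = a} {b} {c} D≥3 i<D j≡D
tCase-InI {a = a} {b} {c} D≥3 (on-i i≡D j<D) = InI-swap (on-j-InI {a = a} {c} {b} D≥3 j<D i≡D)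
tCase-InI {a = a} {b} {c} D≥3 (on-both i≡D j≡D) = on-both-InI {a = a} {b} {c} D≥3 i≡D j≡D

-- If ⌊(m + 1)/2⌋ ≤ n then m ≤ 2n; this is how the floor conditions of 𝓘 are used.
⌊suc[m]/2⌋≤n⇒m≤n+n : ∀ m n → ⌊ suc m /2⌋ ≤ n → m ≤ n + n
⌊suc[m]/2⌋≤n⇒m≤n+n m n h = ≮⇒≥ λ n+n<m →
  <⇒≱ (subst (_≤ ⌊ suc m /2⌋) (cong suc (sym (n≡⌊n+n/2⌋ n))) (⌊n/2⌋-mono (s≤s n+n<m))) h

-- The sizes (a, b, c, e) = (|A ∩ B|, |A ∖ B|, |B ∖ A|, |∁A ∩ ∁B|) of the four
-- cells cut out by two labelled differences A, B ⊆ S.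
Profile : Set
Profile = ℕ × ℕ × ℕ × ℕ

tOf : ℕ → Profile → ℕ
tOf D (a , b , c , e) = tFormula D (a + b) (a + c) a b c

shape : ℕ → Profile → ℕ × ℕ × ℕ
shape D (a , b , c , e) = a + b , a + c , tOf D (a , b , c , e)

Admissible : ℕ → Profile → Set
Admissible D (a , b , c , e) = (a + b ≤ D) × (a + c ≤ D) × ((a + b) + (c + e) ≡ D + D)

tCaseOf : ∀ {D a b c e} → Admissible D (a , b , c , e) → TCase D (a + b) (a + c) a b c (tOf D (a , b , c , e))
tCaseOf {a = a} {b} {c} (i≤D , j≤D , _) = tCase a b c i≤D j≤D

profile-InI : ∀ {D a b c e} → 3 ≤ D → Admissible D (a , b , c , e) → InI D (shape D (a , b , c , e))
profile-InI D≥3 adm = tCase-InI D≥3 (tCaseOf adm)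

on-both-cells : ∀ {D a b c e} → Admissible D (a , b , c , e) → a + b ≡ D → a + c ≡ D → c ≡ b × e ≡ a
on-both-cells {D} {a} {b} {c} {e} (_ , _ , total) i≡D j≡D = c≡b , e≡a
  where
  c≡b = +-cancelˡ-≡ a c b (trans j≡D (sym i≡D))
  c+e≡D : c + e ≡ D
  c+e≡D = +-cancelˡ-≡ D (c + e) D (trans (cong (_+ (c + e)) (sym i≡D)) total)
  e≡a = +-cancelˡ-≡ c e a (trans c+e≡D (trans (sym j≡D) (+-comm a c)))

-- The cell of points lying in side s₁ of A and side s₂ of B
-- (true: inside, false: outside).
entry : Bool → Bool → Profile → ℕ
entry true  true  (a , _ , _ , _) = a
entry true  false (_ , b , _ , _) = b
entry false true  (_ , _ , c , _) = c
entry false false (_ , _ , _ , e) = e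

-- A labelled difference may be replaced by its complement exactly when
-- both have D elements.
Feasible : ℕ → Profile → Bool → Bool → Set
Feasible D (a , b , c , e) s₁ s₂ = (s₁ ≡ false → a + b ≡ D) × (s₂ ≡ false → a + c ≡ D)

-- t is the largest cell among the feasible choices of sides ...
tOf-upper : ∀ {D a b c e} s₁ s₂ → Admissible D (a , b , c , e) → Feasible D (a , b , c , e) s₁ s₂ →
  entry s₁ s₂ (a , b , c , e) ≤ tOf D (a , b , c , e)
tOf-upper {D} {a} {b} {c} {e} s₁ s₂ adm feasible = bound s₁ s₂ feasible (tCaseOf adm)
  where
  bound : ∀ {t} s₁ s₂ → Feasible D (a , b , c , e) s₁ s₂ → TCase D (a + b) (a + c) a b c t →
    entry s₁ s₂ (a , b , c , e) ≤ t
  bound true  true  _ (inner _ _)   = ≤-refl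
  bound true  true  _ (on-j _ _)    = m≤m⊔n a b
  bound true  true  _ (on-i _ _)    = m≤m⊔n a c
  bound true  true  _ (on-both _ _) = m≤m⊔n a b
  bound true  false _ (on-j _ _)    = m≤n⊔m a b
  bound true  false _ (on-both _ _) = m≤n⊔m a b
  bound false true  _ (on-i _ _)    = m≤n⊔m a c
  bound false true  _ (on-both i≡D j≡D) =
    subst (_≤ a ⊔ b) (sym (proj₁ (on-both-cells adm i≡D j≡D))) (m≤n⊔m a b)
  bound false false _ (on-both i≡D j≡D) =
    subst (_≤ a ⊔ b) (sym (proj₂ (on-both-cells adm i≡D j≡D))) (m≤m⊔n a b)
  bound s₁ false (_ , j≡D) (inner _ j<D) = ⊥-elim (<-irrefl (j≡D refl) j<D)
  bound s₁ false (_ , j≡D) (on-i _ j<D) = ⊥-elim (<-irrefl (j≡D refl) j<D)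
  bound false s₂ (i≡D , _) (inner i<D _) = ⊥-elim (<-irrefl (i≡D refl) i<D)
  bound false s₂ (i≡D , _) (on-j i<D _) = ⊥-elim (<-irrefl (i≡D refl) i<D)

tOf-attained : ∀ {D a b c e} → Admissible D (a , b , c , e) →
  Σ[ s₁ ∈ Bool ] Σ[ s₂ ∈ Bool ] Feasible D (a , b , c , e) s₁ s₂ × entry s₁ s₂ (a , b , c , e) ≡ tOf D (a , b , c , e)
tOf-attained {D} {a} {b} {c} {e} adm = attain (tCaseOf adm)
  where
  Attains : ℕ → Set
  Attains t = Σ[ s₁ ∈ Bool ] Σ[ s₂ ∈ Bool ] Feasible D (a , b , c , e) s₁ s₂ × entry s₁ s₂ (a , b , c , e) ≡ t
  max-ab : a + c ≡ D → Attains (a ⊔ b)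
  max-ab j≡D with ≤-total b a
  ... | inj₁ b≤a = true , true , ((λ ()) , (λ ())) , sym (m≥n⇒m⊔n≡m b≤a)
  ... | inj₂ a≤b = true , false , ((λ ()) , (λ _ → j≡D)) , sym (m≤n⇒m⊔n≡n a≤b)
  max-ac : a + b ≡ D → Attains (a ⊔ c)
  max-ac i≡D with ≤-total c a
  ... | inj₁ c≤a = true , true , ((λ ()) , (λ ())) , sym (m≥n⇒m⊔n≡m c≤a)
  ... | inj₂ a≤c = false , true , ((λ _ → i≡D) , (λ ())) , sym (m≤n⇒m⊔n≡n a≤c)
  attain : ∀ {t} → TCase D (a + b) (a + c) a b c t → Attains t
  attain (inner _ _)       = true , true , ((λ ()) , (λ ())) , refl
  attain (on-j _ j≡D)      = max-ab j≡D
  attain (on-i i≡D _)      = max-ac i≡D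
  attain (on-both _ j≡D)   = max-ab j≡D

tFormula-canonical : ∀ {D i j t} → InI D (i , j , t) → tFormula D i j t (i ∸ t) (j ∸ t) ≡ t
tFormula-canonical {D} {i} {j} {t} (_ , _ , i≤D , j≤D , _ , at-i , at-j) =
  value (tCase t (i ∸ t) (j ∸ t) i≤D j≤D)
  where
  excess≤t : ∀ m → ⌊ suc m /2⌋ ≤ t → m ∸ t ≤ t
  excess≤t m h = m≤n+o⇒m∸n≤o m t (⌊suc[m]/2⌋≤n⇒m≤n+n m t h)
  value : ∀ {u} → TCase D i j t (i ∸ t) (j ∸ t) u → u ≡ t
  value (inner _ _)     = refl
  value (on-j _ j≡D)    = m≥n⇒m⊔n≡m (excess≤t i (at-j j≡D))
  value (on-i i≡D _)    = m≥n⇒m⊔n≡m (excess≤t j (at-i i≡D))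
  value (on-both _ j≡D) = m≥n⇒m⊔n≡m (excess≤t i (at-j j≡D))

-- Every (i, j, t) ∈ 𝓘 is the shape of an admissible profile whose last
-- cell is nonempty (so that a vertex avoiding 1 can be placed there).
realizing-profile : ∀ {D i j t} → 1 ≤ D → InI D (i , j , t) →
  Σ[ e ∈ ℕ ] Admissible D (t , i ∸ t , j ∸ t , suc e)
realizing-profile {D} {i} {j} {t} D≥1 (t≤i , t≤j , i≤D , j≤D , i+j≤ , _) =
  e , ≤-trans (≤-reflexive (m+[n∸m]≡n t≤i)) i≤D , ≤-trans (≤-reflexive (m+[n∸m]≡n t≤j)) j≤D , total
  where
  -- the union A ∪ B has |A ∪ B| = i + (j − t) ≤ 2D − 2 elements
  union = i + (j ∸ t)
  union+2≤D+D : union + 2 ≤ D + D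
  union+2≤D+D = subst (union + 2 ≤_) (2D∸2+2 D D≥1)
    (+-monoˡ-≤ 2 (+-cancelʳ-≤ t union (2 * D ∸ 2)
      (subst (_≤ (2 * D ∸ 2) + t) (trans (cong (i +_) (sym (m∸n+n≡m t≤j))) (sym (+-assoc i (j ∸ t) t))) i+j≤)))
  e = (D + D) ∸ (union + 1)
  total : (t + (i ∸ t)) + ((j ∸ t) + suc e) ≡ D + D
  total = begin
    (t + (i ∸ t)) + ((j ∸ t) + suc e) ≡⟨ cong (_+ ((j ∸ t) + suc e)) (m+[n∸m]≡n t≤i) ⟩
    i + ((j ∸ t) + suc e)             ≡⟨ regroup i (j ∸ t) e ⟩
    (union + 1) + e                   ≡⟨ m+[n∸m]≡n (≤-trans (+-monoʳ-≤ union (s≤s z≤n)) union+2≤D+D) ⟩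
    D + D                             ∎
    where
    open ≡-Reasoning
    regroup : ∀ i k e → i + (k + suc e) ≡ (i + k + 1) + e
    regroup = solve-∀

side : Bool → Subset n → Subset n
side true  p = p
side false p = ∁ p

side-≈ₛ : ∀ s (p : Subset n) → side s p ≈ₛ p
side-≈ₛ true  p = inj₁ refl
side-≈ₛ false p = inj₂ refl

profile : Subset n → Subset n → Profile
profile A B = ∣ A ∩ B ∣ , ∣ A ∩ ∁ B ∣ , ∣ ∁ A ∩ B ∣ , ∣ ∁ A ∩ ∁ B ∣

entry-profile : ∀ s₁ s₂ (A B : Subset n) → ∣ side s₁ A ∩ side s₂ B ∣ ≡ entry s₁ s₂ (profile A B)
entry-profile true  true  A B = refl
entry-profile true  false A B = refl
entry-profile false true  A B = refl
entry-profile false false A B = refl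

profile-total : (A B : Subset n) → (∣ A ∩ B ∣ + ∣ A ∩ ∁ B ∣) + (∣ ∁ A ∩ B ∣ + ∣ ∁ A ∩ ∁ B ∣) ≡ n
profile-total A B = trans (cong₂ _+_ (sym (∣p∣-split A B)) (sym (∣p∣-split (∁ A) B))) (∣p∣+∣∁p∣ A)

cells-determined : ∀ {a b c e a' b' c' e'} → a ≡ a' → a + b ≡ a' + b' → a + c ≡ a' + c' →
  (a + b) + (c + e) ≡ (a' + b') + (c' + e') → (a , b , c , e) ≡ (a' , b' , c' , e')
cells-determined {a} {b} {c} {e} {b' = b'} {c'} {e'} refl sum-b sum-c total
  with +-cancelˡ-≡ a b b' sum-b | +-cancelˡ-≡ a c c' sum-c
... | refl | refl = cong (λ e → a , b , c , e) (+-cancelˡ-≡ c e e' (+-cancelˡ-≡ (a + b) (c + e) (c + e') total))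

profile-determined : (A B A' B' : Subset n) →
  ∣ A ∣ ≡ ∣ A' ∣ → ∣ B ∣ ≡ ∣ B' ∣ → ∣ A ∩ B ∣ ≡ ∣ A' ∩ B' ∣ → profile A B ≡ profile A' B'
profile-determined A B A' B' sameA sameB sameAB = cells-determined sameAB
  (trans (sym (∣p∣-split A B)) (trans sameA (∣p∣-split A' B')))
  (trans (sym (∣q∣-split A B)) (trans sameB (∣q∣-split A' B')))
  (trans (profile-total A B) (sym (profile-total A' B')))

△-if : ∀ b (p q : Subset n) → p △ (if b then q else ∁ q) ≡ (if b then p △ q else ∁ (p △ q))
△-if true  p q = refl
△-if false p q = △-∁ʳ p q

-- The labelled difference x₁ △ y₁ of the paper (with y₁ = label x y): the
-- smaller representative of the bipartition determined by x △ y.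
Δ : ∀ {D} → X D → X D → Subset (2 * D)
Δ x y = part x △ label x y

Δ-rep : ∀ {D} (x y : X D) → SmallRep D (part x △ part y) (Δ x y)
Δ-rep {D} x y = subst (SmallRep D (part x △ part y))
  (sym (△-if (∣ part x △ part y ∣ ≤ᵇ D) (part x) (part y))) (smallSide-rep D (part x △ part y))

∣Δ∣≡dist : ∀ {D} (x y : X D) → ∣ Δ x y ∣ ≡ dist x y
∣Δ∣≡dist x y = trans (SmallRep.size (Δ-rep x y)) (sym (dist≡∥△∥ x y))

t3 : ∀ {D} → X D → X D → X D → ℕ
t3 x y z = proj₂ (proj₂ (dist3 x y z))

cellsOf : ∀ {D} → X D → X D → X D → Profile
cellsOf x y z = profile (Δ x y) (Δ x z)

cellsOf-admissible : ∀ {D} (x y z : X D) → Admissible D (cellsOf x y z)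
cellsOf-admissible {D} x y z =
  subst (_≤ D) (∣p∣-split A B) (SmallRep.small (Δ-rep x y)) ,
  subst (_≤ D) (∣q∣-split A B) (SmallRep.small (Δ-rep x z)) ,
  trans (profile-total A B) (2*D≡D+D D)
  where
  A = Δ x y
  B = Δ x z

dist3-shape : ∀ {D} (x y z : X D) → dist3 x y z ≡ shape D (cellsOf x y z)
dist3-shape {D} x y z = cong₂ _,_ i≡ (cong₂ _,_ j≡ t≡)
  where
  A = Δ x y
  B = Δ x z
  i≡ : dist x y ≡ ∣ A ∩ B ∣ + ∣ A ∩ ∁ B ∣
  i≡ = trans (sym (∣Δ∣≡dist x y)) (∣p∣-split A B)
  j≡ : dist x z ≡ ∣ A ∩ B ∣ + ∣ ∁ A ∩ B ∣
  j≡ = trans (sym (∣Δ∣≡dist x z)) (∣q∣-split A B)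
  t≡ : t3 x y z ≡ tOf D (cellsOf x y z)
  t≡ = begin
    t3 x y z
      ≡⟨ cong₂ (λ u v → tFormula D (dist x y) (dist x z) (∣ A ∩ B ∣) (∣ A ∩ u ∣) (∣ v ∩ B ∣))
           (△-∁ʳ (part x) (label x z)) (△-∁ʳ (part x) (label x y)) ⟩
    tFormula D (dist x y) (dist x z) (∣ A ∩ B ∣) (∣ A ∩ ∁ B ∣) (∣ ∁ A ∩ B ∣)
      ≡⟨ cong₂ (λ i j → tFormula D i j (∣ A ∩ B ∣) (∣ A ∩ ∁ B ∣) (∣ ∁ A ∩ B ∣)) i≡ j≡ ⟩
    tOf D (cellsOf x y z) ∎
    where open ≡-Reasoning

dist3-InI : ∀ D → 3 ≤ D → (a : Triple D) → InI D (dist3T a)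
dist3-InI D D≥3 (x , y , z) = subst (InI D) (sym (dist3-shape x y z)) (profile-InI D≥3 (cellsOf-admissible x y z))

-- Two subsets with a prescribed profile; the cell ∁A ∩ ∁B is listed first,
-- so that it contains the point 1 when it is nonempty.
cellPair : (e a b c : ℕ) → Subset (e + (a + (b + c))) × Subset (e + (a + (b + c)))
cellPair (suc e) a       b       c       = let (P , Q) = cellPair e a b c in false ∷ P , false ∷ Q
cellPair zero    (suc a) b       c       = let (P , Q) = cellPair zero a b c in true ∷ P , true ∷ Q
cellPair zero    zero    (suc b) c       = let (P , Q) = cellPair zero zero b c in true ∷ P , false ∷ Q
cellPair zero    zero    zero    (suc c) = let (P , Q) = cellPair zero zero zero c in false ∷ P , true ∷ Q
cellPair zero    zero    zero    zero    = [] , []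

cellPair-profile : ∀ e a b c → profile (proj₁ (cellPair e a b c)) (proj₂ (cellPair e a b c)) ≡ (a , b , c , e)
cellPair-profile (suc e) a b c = cong (λ { (a , b , c , e) → a , b , c , suc e }) (cellPair-profile e a b c)
cellPair-profile zero (suc a) b c = cong (λ { (a , b , c , e) → suc a , b , c , e }) (cellPair-profile zero a b c)
cellPair-profile zero zero (suc b) c = cong (λ { (a , b , c , e) → a , suc b , c , e }) (cellPair-profile zero zero b c)
cellPair-profile zero zero zero (suc c) = cong (λ { (a , b , c , e) → a , b , suc c , e }) (cellPair-profile zero zero zero c)
cellPair-profile zero zero zero zero = refl

vertexPair : ∀ {N} e a b c → suc e + (a + (b + c)) ≡ N →
  Σ[ A ∈ Subset N ] Σ[ B ∈ Subset N ] profile A B ≡ (a , b , c , suc e) × T (firstOut A) × T (firstOut B)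
vertexPair e a b c refl = proj₁ (cellPair (suc e) a b c) , proj₂ (cellPair (suc e) a b c) , cellPair-profile (suc e) a b c , _ , _

origin : ∀ {D} → X D
origin {D} = vertex ⊥ (firstOut-⊥ (2 * D))
  where
  firstOut-⊥ : ∀ n → T (firstOut (⊥ {n}))
  firstOut-⊥ zero    = _
  firstOut-⊥ (suc n) = _

Δ-origin : ∀ {D} (y : X D) → ∣ part y ∣ ≤ D → Δ origin y ≡ part y
Δ-origin {D} y small = trans (cong (⊥ △_) y₁≡) (⊕-identityˡ (part y))
  where
  y₁≡ : label origin y ≡ part y
  y₁≡ = cong (λ b → if b then part y else ∁ (part y))
    (Equivalence.to T-≡ (≤⇒≤ᵇ (subst (λ w → ∣ w ∣ ≤ D) (sym (⊕-identityˡ (part y))) small)))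

triple-with-profile : ∀ {D a b c e} → Admissible D (a , b , c , suc e) →
  Σ[ y ∈ X D ] Σ[ z ∈ X D ] cellsOf origin y z ≡ (a , b , c , suc e)
triple-with-profile {D} {a} {b} {c} {e} (first≤D , second≤D , total) =
  y , z , trans (cong₂ profile (Δ-origin y (small ∣A∣≡ first≤D)) (Δ-origin z (small ∣B∣≡ second≤D))) cells≡
  where
  reorder : ∀ a b c e → suc e + (a + (b + c)) ≡ (a + b) + (c + suc e)
  reorder = solve-∀
  realized = vertexPair e a b c (trans (reorder a b c e) (trans total (sym (2*D≡D+D D))))
  A = proj₁ realized
  B = proj₁ (proj₂ realized)
  cells≡ = proj₁ (proj₂ (proj₂ realized))
  y z : X D
  y = vertex A (proj₁ (proj₂ (proj₂ (proj₂ realized))))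
  z = vertex B (proj₂ (proj₂ (proj₂ (proj₂ realized))))
  ∣A∣≡ : ∣ A ∣ ≡ a + b
  ∣A∣≡ = trans (∣p∣-split A B) (cong (λ { (a , b , _ , _) → a + b }) cells≡)
  ∣B∣≡ : ∣ B ∣ ≡ a + c
  ∣B∣≡ = trans (∣q∣-split A B) (cong (λ { (a , _ , c , _) → a + c }) cells≡)
  small : ∀ {m k} → m ≡ k → k ≤ D → m ≤ D
  small m≡k k≤D = ≤-trans (≤-reflexive m≡k) k≤D

shape-canonical : ∀ {D i j t} e → InI D (i , j , t) → shape D (t , i ∸ t , j ∸ t , e) ≡ (i , j , t)
shape-canonical {D} {i} {j} {t} e I@(t≤i , t≤j , _) = begin
    shape D (t , i ∸ t , j ∸ t , e)           ≡⟨ cong₂ (λ i' j' → i' , j' , tFormula D i' j' t (i ∸ t) (j ∸ t))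
                                                   (m+[n∸m]≡n t≤i) (m+[n∸m]≡n t≤j) ⟩
    i , j , tFormula D i j t (i ∸ t) (j ∸ t)  ≡⟨ cong (λ u → i , j , u) (tFormula-canonical I) ⟩
    i , j , t                                 ∎
  where open ≡-Reasoning

dist3-onto : ∀ D → 3 ≤ D → (ijt : ℕ × ℕ × ℕ) → InI D ijt → Σ[ a ∈ Triple D ] dist3T a ≡ ijt
dist3-onto D D≥3 (i , j , t) I =
  (origin , y , z) , trans (dist3-shape origin y z) (trans (cong (shape D) cells≡) (shape-canonical (suc e) I))
  where
  realizing = realizing-profile (≤-trans (s≤s z≤n) D≥3) I
  e = proj₁ realizing
  realized = triple-with-profile (proj₂ realizing)
  y = proj₁ realized
  z = proj₁ (proj₂ realized)
  cells≡ = proj₂ (proj₂ realized)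

canonical : Subset n → Subset n
canonical p = if firstOut p then p else ∁ p

canonical-≈ₛ : (p : Subset n) → canonical p ≈ₛ p
canonical-≈ₛ []          = inj₁ refl
canonical-≈ₛ (false ∷ p) = inj₁ refl
canonical-≈ₛ (true ∷ p)  = inj₂ refl

canonical-avoids : (p : Subset n) → T (firstOut (canonical p))
canonical-avoids []          = _
canonical-avoids (false ∷ p) = _
canonical-avoids (true ∷ p)  = _

toVertex : ∀ {D} → Subset (2 * D) → X D
toVertex p = vertex (canonical p) (canonical-avoids p)

avoids-complement : (p : Subset n) → T (firstOut p) → T (firstOut (∁ p)) → p ≡ ∁ p
avoids-complement []          _ _ = refl
avoids-complement (false ∷ p) _ ()

vertex-≡ : ∀ {D} {u v : X D} → part u ≡ part v → u ≡ v
vertex-≡ {u = vertex p p∌1} {vertex .p q∌1} refl = cong (vertex p) (T-irrelevant p∌1 q∌1)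

vertex-≈ₛ : ∀ {D} (u v : X D) → part u ≈ₛ part v → u ≡ v
vertex-≈ₛ u v (inj₁ u≡v)  = vertex-≡ u≡v
vertex-≈ₛ u v (inj₂ u≡∁v) = vertex-≡ (trans u≡∁v (sym v≡∁v))
  where v≡∁v = avoids-complement (part v) (1∉part v) (subst (λ p → T (firstOut p)) u≡∁v (1∉part u))

dist-≈ₛ : ∀ {D} (u v : X D) {p q : Subset (2 * D)} → part u ≈ₛ p → part v ≈ₛ q → dist u v ≡ ∥ p △ q ∥
dist-≈ₛ u v {p} u≈p v≈q = trans (dist≡∥△∥ u v) (∥∥-≈ₛ (≈ₛ-trans (≈ₛ-△ʳ (part v) u≈p) (≈ₛ-△ˡ p v≈q)))

smaller : (w : Subset n) → Σ[ w' ∈ Subset n ] w' ≈ₛ w × ∣ w' ∣ ≡ ∥ w ∥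
smaller w with ⊓-sel ∣ w ∣ ∣ ∁ w ∣
... | inj₁ ∥w∥≡∣w∣  = w , inj₁ refl , sym ∥w∥≡∣w∣
... | inj₂ ∥w∥≡∣∁w∣ = ∁ w , inj₂ refl , sym ∥w∥≡∣∁w∣

∣p∣≡0⇒p≡⊥ : (p : Subset n) → ∣ p ∣ ≡ 0 → p ≡ ⊥
∣p∣≡0⇒p≡⊥ []          _     = refl
∣p∣≡0⇒p≡⊥ (false ∷ p) ∣p∣≡0 = cong (false ∷_) (∣p∣≡0⇒p≡⊥ p ∣p∣≡0)

△≡⊥⇒≡ : (p q : Subset n) → p △ q ≡ ⊥ → p ≡ q
△≡⊥⇒≡ p q p△q≡⊥ = trans (sym (△-cancelʳ p q)) (trans (cong (_△ q) p△q≡⊥) (⊕-identityˡ q))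

dist-zero : ∀ {D} (x y : X D) → dist x y ≡ 0 → x ≡ y
dist-zero x y dist≡0 with smaller (part x △ part y)
... | w , w≈ , ∣w∣≡ = vertex-≈ₛ x y (same (≈ₛ-trans (≈ₛ-sym w≈) (inj₁ (∣p∣≡0⇒p≡⊥ w (trans ∣w∣≡ (trans (sym (dist≡∥△∥ x y)) dist≡0))))))
  where
  same : (part x △ part y) ≈ₛ ⊥ → part x ≈ₛ part y
  same (inj₁ △≡⊥)  = inj₁ (△≡⊥⇒≡ _ _ △≡⊥)
  same (inj₂ △≡∁⊥) = inj₂ (△≡⊥⇒≡ _ _ (trans (△-∁ʳ (part x) (part y)) (trans (cong ∁ △≡∁⊥) (¬-involutive ⊥))))

dist-self : ∀ {D} (x : X D) → dist x x ≡ 0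
dist-self {D} x = trans (dist≡∥△∥ x x) (trans (cong ∥_∥ (⊕-inverseʳ (part x))) (cong (_⊓ ∣ ∁ (⊥ {2 * D}) ∣) (∣⊥∣≡0 (2 * D))))

∣p△q∣≤∣p∣+∣q∣ : (p q : Subset n) → ∣ p △ q ∣ ≤ ∣ p ∣ + ∣ q ∣
∣p△q∣≤∣p∣+∣q∣ p q = subst (_≤ ∣ p ∣ + ∣ q ∣) (sym (∣p△q∣ p q)) (+-mono-≤ (∣p∩q∣≤∣p∣ p (∁ q)) (∣p∩q∣≤∣q∣ (∁ p) q))

∥p△q∥≤∥p∥+∥q∥ : (p q : Subset n) → ∥ p △ q ∥ ≤ ∥ p ∥ + ∥ q ∥
∥p△q∥≤∥p∥+∥q∥ p q with smaller p | smaller q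
... | p' , p'≈p , ∣p'∣≡ | q' , q'≈q , ∣q'∣≡ = begin
  ∥ p △ q ∥     ≡⟨ ∥∥-≈ₛ (≈ₛ-trans (≈ₛ-△ˡ p' q'≈q) (≈ₛ-△ʳ q p'≈p)) ⟨
  ∥ p' △ q' ∥   ≤⟨ m⊓n≤m _ _ ⟩
  ∣ p' △ q' ∣   ≤⟨ ∣p△q∣≤∣p∣+∣q∣ p' q' ⟩
  ∣ p' ∣ + ∣ q' ∣ ≡⟨ cong₂ _+_ ∣p'∣≡ ∣q'∣≡ ⟩
  ∥ p ∥ + ∥ q ∥ ∎
  where open ≤-Reasoning

dist-triangle : ∀ {D} (x w y : X D) → dist x y ≤ dist x w + dist w y
dist-triangle x w y = subst₂ _≤_ (trans (cong ∥_∥ chain) (sym (dist≡∥△∥ x y))) (sym (cong₂ _+_ (dist≡∥△∥ x w) (dist≡∥△∥ w y)))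
  (∥p△q∥≤∥p∥+∥q∥ (part x △ part w) (part w △ part y))
  where
  chain : (part x △ part w) △ (part w △ part y) ≡ part x △ part y
  chain = trans (cong ((part x △ part w) △_) (⊕-comm (part w) (part y))) (△-translate (part x) (part y) (part w))

move : ∀ {D} → X D → Subset (2 * D) → X D
move x C = toVertex (part x △ C)

dist-from-move : ∀ {D} (x : X D) (C : Subset (2 * D)) → dist x (move x C) ≡ ∥ C ∥
dist-from-move x C = trans (dist-≈ₛ x (move x C) (inj₁ refl) (canonical-≈ₛ (part x △ C))) (cong ∥_∥ (△-cancelˡ (part x) C))

dist-move : ∀ {D} (x : X D) (C : Subset (2 * D)) (v : X D) → dist (move x C) v ≡ ∥ C △ (part x △ part v) ∥
dist-move x C v = trans (dist-≈ₛ (move x C) v (canonical-≈ₛ (part x △ C)) (inj₁ refl))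
  (cong ∥_∥ (trans (cong (_△ part v) (⊕-comm (part x) C)) (⊕-assoc C (part x) (part v))))

remove-point : ∀ {k} (V : Subset n) → ∣ V ∣ ≡ suc k →
  Σ[ E ∈ Subset n ] ∣ E ∣ ≡ 1 × ∣ V △ E ∣ ≡ k × ∣ ∁ (V △ E) ∣ ≡ suc ∣ ∁ V ∣
remove-point {suc n} (true ∷ V) ∣V∣≡ =
  true ∷ ⊥ , cong suc (∣⊥∣≡0 n) , trans (cong ∣_∣ (⊕-identityʳ V)) (suc-injective ∣V∣≡) ,
  cong (λ W → suc ∣ ∁ W ∣) (⊕-identityʳ V)
remove-point (false ∷ V) ∣V∣≡ with remove-point V ∣V∣≡
... | E , ∣E∣≡1 , ∣V△E∣≡ , ∣∁V△E∣≡ = false ∷ E , ∣E∣≡1 , ∣V△E∣≡ , cong suc ∣∁V△E∣≡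

shrink : ∀ {D k} → 1 ≤ D → (W : Subset (2 * D)) → ∥ W ∥ ≡ suc k →
  Σ[ E ∈ Subset (2 * D) ] ∥ E ∥ ≡ 1 × ∥ W △ E ∥ ≡ k
shrink {D} {k} D≥1 W ∥W∥≡ with smaller W
... | V , V≈W , ∣V∣≡∥W∥ with remove-point V (trans ∣V∣≡∥W∥ ∥W∥≡)
... | E , ∣E∣≡1 , ∣V△E∣≡k , ∣∁V△E∣≡ = E , ∥E∥≡1 , ∥W△E∥≡k
  where
  1≤∣∁E∣ : 1 ≤ ∣ ∁ E ∣
  1≤∣∁E∣ = s≤s⁻¹ (subst (2 ≤_) (trans (sym (∣w∣+∣∁w∣≡D+D {D} E)) (cong (_+ ∣ ∁ E ∣) ∣E∣≡1)) (+-mono-≤ D≥1 D≥1))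
  ∥E∥≡1 : ∥ E ∥ ≡ 1
  ∥E∥≡1 = trans (cong (_⊓ ∣ ∁ E ∣) ∣E∣≡1) (m≤n⇒m⊓n≡m 1≤∣∁E∣)
  -- V is the smaller side, so |V| ≤ |∁ V|
  k≤∣∁V∣ : k ≤ ∣ ∁ V ∣
  k≤∣∁V∣ = ≤-trans (n≤1+n k)
    (subst (_≤ ∣ ∁ V ∣) (trans (∥∥-≈ₛ V≈W) ∥W∥≡) (m⊓n≤n ∣ V ∣ ∣ ∁ V ∣))
  ∥W△E∥≡k : ∥ W △ E ∥ ≡ k
  ∥W△E∥≡k = begin
    ∥ W △ E ∥         ≡⟨ ∥∥-≈ₛ (≈ₛ-△ʳ E V≈W) ⟨
    ∥ V △ E ∥         ≡⟨ cong₂ _⊓_ ∣V△E∣≡k ∣∁V△E∣≡ ⟩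
    k ⊓ suc ∣ ∁ V ∣   ≡⟨ m≤n⇒m⊓n≡m (m≤n⇒m≤1+n k≤∣∁V∣) ⟩
    k                 ∎
    where open ≡-Reasoning

-- The folded cube is connected and dist is its path metric: from x one step
-- along an edge gets one closer to y.
geodesic-step : ∀ {D} → 1 ≤ D → (x y : X D) → ∀ k → dist x y ≡ suc k →
  Σ[ w ∈ X D ] Adjacent x w × dist w y ≡ k
geodesic-step {D} D≥1 x y k dist≡ = move x E , trans (dist-from-move x E) ∥E∥≡1 ,
  trans (dist-move x E y) (trans (cong ∥_∥ (⊕-comm E (part x △ part y))) ∥W△E∥≡k)
  where
  shrunk = shrink {D} D≥1 (part x △ part y) (trans (sym (dist≡∥△∥ x y)) dist≡)
  E = proj₁ shrunk
  ∥E∥≡1 = proj₁ (proj₂ shrunk)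
  ∥W△E∥≡k = proj₂ (proj₂ shrunk)

nonexpansive : ∀ {D} → 1 ≤ D → (h : X D → X D) → (∀ u v → Adjacent u v → Adjacent (h u) (h v)) →
  ∀ k (x y : X D) → dist x y ≡ k → dist (h x) (h y) ≤ k
nonexpansive D≥1 h h-adj zero x y dist≡0 =
  ≤-reflexive (trans (cong (λ v → dist (h x) (h v)) (sym (dist-zero x y dist≡0))) (dist-self (h x)))
nonexpansive D≥1 h h-adj (suc k) x y dist≡ = begin
  dist (h x) (h y)                     ≤⟨ dist-triangle (h x) (h w) (h y) ⟩
  dist (h x) (h w) + dist (h w) (h y)  ≡⟨ cong (_+ dist (h w) (h y)) (h-adj x w x~w) ⟩
  suc (dist (h w) (h y))               ≤⟨ s≤s (nonexpansive D≥1 h h-adj k w y dist-w-y≡k) ⟩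
  suc k                                ∎
  where
  open ≤-Reasoning
  step = geodesic-step D≥1 x y k dist≡
  w = proj₁ step
  x~w = proj₁ (proj₂ step)
  dist-w-y≡k = proj₂ (proj₂ step)

module Automorphism {D : ℕ} (f : X D → X D) (f-aut : IsAut f) where

  inverse : X D → X D
  inverse y = proj₁ (proj₂ (proj₁ f-aut) y)

  f∘inverse : ∀ y → f (inverse y) ≡ y
  f∘inverse y = proj₂ (proj₂ (proj₁ f-aut) y) refl

  inverse∘f : ∀ x → inverse (f x) ≡ x
  inverse∘f x = proj₁ (proj₁ f-aut) (f∘inverse (f x))

  preserves-dist : 1 ≤ D → ∀ x y → dist (f x) (f y) ≡ dist x y
  preserves-dist D≥1 x y = ≤-antisym (nonexpansive D≥1 f f-adj _ x y refl)
    (subst (_≤ dist (f x) (f y)) (cong₂ dist (inverse∘f x) (inverse∘f y))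
      (nonexpansive D≥1 inverse inverse-adj _ (f x) (f y) refl))
    where
    f-adj : ∀ u v → Adjacent u v → Adjacent (f u) (f v)
    f-adj u v = Equivalence.to (proj₂ f-aut u v)
    inverse-adj : ∀ u v → Adjacent u v → Adjacent (inverse u) (inverse v)
    inverse-adj u v u~v = Equivalence.from (proj₂ f-aut (inverse u) (inverse v))
      (subst₂ Adjacent (sym (f∘inverse u)) (sym (f∘inverse v)) u~v)

≈ₛ-side : {p q : Subset n} → p ≈ₛ q → Σ[ s ∈ Bool ] p ≡ side s q
≈ₛ-side (inj₁ p≡q)  = true , p≡q
≈ₛ-side (inj₂ p≡∁q) = false , p≡∁q

both-small : ∀ {D} (w : Subset (2 * D)) → ∣ w ∣ ≤ D → ∣ ∁ w ∣ ≤ D → ∣ w ∣ ≡ D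
both-small {D} w w≤D ∁w≤D = ≤-antisym w≤D (+-cancelʳ-≤ D D ∣ w ∣
  (subst (_≤ ∣ w ∣ + D) (∣w∣+∣∁w∣≡D+D {D} w) (+-monoʳ-≤ ∣ w ∣ ∁w≤D)))

-- The labelled
-- differences Δ x y, Δ x z form one; complementing one of them gives the
-- others.
record Labelling {D : ℕ} (x y z : X D) : Set where
  constructor labelling
  field
    first    : Subset (2 * D)
    second   : Subset (2 * D)
    first≈   : first ≈ₛ part x △ part y
    second≈  : second ≈ₛ part x △ part z
    first≤D  : ∣ first ∣ ≤ D
    second≤D : ∣ second ∣ ≤ D

module _ {D : ℕ} {x y z : X D} (L : Labelling x y z) where
  open Labelling L

  sides : Σ[ s₁ ∈ Bool ] Σ[ s₂ ∈ Bool ] first ≡ side s₁ (Δ x y) × second ≡ side s₂ (Δ x z)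
  sides with ≈ₛ-side (≈ₛ-trans first≈ (≈ₛ-sym (SmallRep.same (Δ-rep x y))))
           | ≈ₛ-side (≈ₛ-trans second≈ (≈ₛ-sym (SmallRep.same (Δ-rep x z))))
  ... | s₁ , first≡ | s₂ , second≡ = s₁ , s₂ , first≡ , second≡

  first-size : ∣ first ∣ ≡ dist x y
  first-size = trans (sym (∥w∥≡∣w∣ first first≤D)) (trans (∥∥-≈ₛ first≈) (sym (dist≡∥△∥ x y)))

  second-size : ∣ second ∣ ≡ dist x z
  second-size = trans (sym (∥w∥≡∣w∣ second second≤D)) (trans (∥∥-≈ₛ second≈) (sym (dist≡∥△∥ x z)))

  labelling-bound : ∣ first ∩ second ∣ ≤ t3 x y z
  labelling-bound with sides
  ... | s₁ , s₂ , refl , refl = begin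
    ∣ side s₁ (Δ x y) ∩ side s₂ (Δ x z) ∣ ≡⟨ entry-profile s₁ s₂ (Δ x y) (Δ x z) ⟩
    entry s₁ s₂ (cellsOf x y z)           ≤⟨ tOf-upper s₁ s₂ (cellsOf-admissible x y z) (feasible₁ , feasible₂) ⟩
    tOf D (cellsOf x y z)                 ≡⟨ cong (λ d → proj₂ (proj₂ d)) (dist3-shape x y z) ⟨
    t3 x y z                              ∎
    where
    open ≤-Reasoning
    feasible₁ : s₁ ≡ false → _
    feasible₁ refl = trans (sym (∣p∣-split (Δ x y) (Δ x z)))
      (both-small (Δ x y) (SmallRep.small (Δ-rep x y)) first≤D)
    feasible₂ : s₂ ≡ false → _
    feasible₂ refl = trans (sym (∣q∣-split (Δ x y) (Δ x z)))
      (both-small (Δ x z) (SmallRep.small (Δ-rep x z)) second≤D)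

side-small : ∀ {D} s (w : Subset (2 * D)) → ∣ w ∣ ≤ D → (s ≡ false → ∣ w ∣ ≡ D) → ∣ side s w ∣ ≤ D
side-small true  w w≤D _ = w≤D
side-small {D} false w _ ∣w∣≡D = ≤-reflexive (+-cancelˡ-≡ D ∣ ∁ w ∣ D
  (trans (cong (_+ ∣ ∁ w ∣) (sym (∣w∣≡D refl))) (∣w∣+∣∁w∣≡D+D {D} w)))

optimal-labelling : ∀ {D} (x y z : X D) →
  Σ[ L ∈ Labelling x y z ] ∣ Labelling.first L ∩ Labelling.second L ∣ ≡ t3 x y z
optimal-labelling {D} x y z with tOf-attained (cellsOf-admissible x y z)
... | s₁ , s₂ , (feasible₁ , feasible₂) , entry≡t =
  labelling (side s₁ A) (side s₂ B)
    (≈ₛ-trans (side-≈ₛ s₁ A) (SmallRep.same (Δ-rep x y))) (≈ₛ-trans (side-≈ₛ s₂ B) (SmallRep.same (Δ-rep x z)))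
    (side-small s₁ A (SmallRep.small (Δ-rep x y)) (λ s₁≡false → trans (∣p∣-split A B) (feasible₁ s₁≡false)))
    (side-small s₂ B (SmallRep.small (Δ-rep x z)) (λ s₂≡false → trans (∣q∣-split A B) (feasible₂ s₂≡false))) ,
  trans (entry-profile s₁ s₂ A B) (trans entry≡t (cong (λ d → proj₂ (proj₂ d)) (sym (dist3-shape x y z))))
  where
  A = Δ x y
  B = Δ x z

-- The metric meaning of t: it is the largest distance from x of a vertex w
-- lying both on a geodesic from x to y and on one from x to z.
Between : ∀ {D} → X D → X D → X D → Set
Between x w y = dist x w + dist w y ≡ dist x y

-- p ⊆ q, expressed by counting
infix 4 _⊆ᶜ_
_⊆ᶜ_ : Subset n → Subset n → Set
p ⊆ᶜ q = ∣ p ∩ ∁ q ∣ ≡ 0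

⊆ᶜ-∩ : (p q r : Subset n) → p ⊆ᶜ q → p ⊆ᶜ r → ∣ p ∣ ≤ ∣ q ∩ r ∣
⊆ᶜ-∩ [] [] [] _ _ = z≤n
⊆ᶜ-∩ (true ∷ p) (true ∷ q) (true ∷ r) p⊆q p⊆r = s≤s (⊆ᶜ-∩ p q r p⊆q p⊆r)
⊆ᶜ-∩ (true ∷ p) (true ∷ q) (false ∷ r) p⊆q ()
⊆ᶜ-∩ (true ∷ p) (false ∷ q) r () p⊆r
⊆ᶜ-∩ (false ∷ p) (true ∷ q) (true ∷ r) p⊆q p⊆r = m≤n⇒m≤1+n (⊆ᶜ-∩ p q r p⊆q p⊆r)
⊆ᶜ-∩ (false ∷ p) (true ∷ q) (false ∷ r) p⊆q p⊆r = ⊆ᶜ-∩ p q r p⊆q p⊆r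
⊆ᶜ-∩ (false ∷ p) (false ∷ q) (true ∷ r) p⊆q p⊆r = ⊆ᶜ-∩ p q r p⊆q p⊆r
⊆ᶜ-∩ (false ∷ p) (false ∷ q) (false ∷ r) p⊆q p⊆r = ⊆ᶜ-∩ p q r p⊆q p⊆r

-- Arithmetic behind `switched-inside-side`, with k = |C ∩ A|, u = |C ∖ A|,
-- v = |A ∖ C|, r = |∁C ∩ ∁A|.
no-points-outside : ∀ k u v → (u + v) + (k + u) ≡ k + v → u ≡ 0
no-points-outside k u v eq = n≤0⇒n≡0 (≤-trans (m≤m+n u u)
  (≤-reflexive (+-cancelˡ-≡ (k + v) (u + u) 0 (trans (regroup k u v) (trans eq (sym (+-identityʳ (k + v))))))))
  where
  regroup : ∀ k u v → (k + v) + (u + u) ≡ (u + v) + (k + u)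
  regroup = solve-∀

no-points-inside : ∀ {D} k u v r → (k + r) + (k + u) ≡ k + v → (k + u) + (v + r) ≡ D + D → k + v ≤ D →
  k ≡ 0 × k + v ≡ D
no-points-inside {D} k u v r eq total k+v≤D = k≡0 , trans k+v≡D+k (trans (cong (D +_) k≡0) (+-identityʳ D))
  where
  regroup₁ : ∀ k r u → k + (k + r + u) ≡ (k + r) + (k + u)
  regroup₁ = solve-∀
  regroup₂ : ∀ k u r → (k + u + r) + (k + u + r) ≡ (k + u) + ((k + r + u) + r)
  regroup₂ = solve-∀
  regroup₃ : ∀ k r u → k + (k + r + u) ≡ (k + u + r) + k
  regroup₃ = solve-∀
  v≡ : v ≡ k + r + u
  v≡ = sym (+-cancelˡ-≡ k (k + r + u) v (trans (regroup₁ k r u) eq))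
  twice≡ : (k + u + r) + (k + u + r) ≡ D + D
  twice≡ = trans (regroup₂ k u r) (trans (cong (λ w → (k + u) + (w + r)) (sym v≡)) total)
  D≡ : D ≡ k + u + r
  D≡ = ≤-antisym (halve-≤ (≤-reflexive (sym twice≡))) (halve-≤ (≤-reflexive twice≡))
  k+v≡D+k : k + v ≡ D + k
  k+v≡D+k = trans (cong (k +_) v≡) (trans (regroup₃ k r u) (cong (_+ k) (sym D≡)))
  k≡0 : k ≡ 0
  k≡0 = n≤0⇒n≡0 (+-cancelˡ-≤ D k 0 (subst₂ _≤_ k+v≡D+k (sym (+-identityʳ D)) k+v≤D))

-- Going from x towards y through w switches a set C of points (|C| = ∂(x,w))
-- lying inside one side A' of the bipartition x △ y with |A'| ≤ D.
switched-inside-side : ∀ {D} (C A : Subset (2 * D)) → ∣ A ∣ ≤ D → ∥ C △ A ∥ + ∣ C ∣ ≡ ∣ A ∣ →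
  Σ[ A' ∈ Subset (2 * D) ] A' ≈ₛ A × ∣ A' ∣ ≤ D × C ⊆ᶜ A'
switched-inside-side {D} C A A≤D on-geodesic = inside-or-outside (⊓-sel ∣ C △ A ∣ ∣ ∁ (C △ A) ∣)
  where
  k = ∣ C ∩ A ∣
  u = ∣ C ∩ ∁ A ∣
  v = ∣ ∁ C ∩ A ∣
  r = ∣ ∁ C ∩ ∁ A ∣
  ∣A∣≡ : ∣ A ∣ ≡ k + v
  ∣A∣≡ = ∣q∣-split C A
  balance : ∀ {m} → ∥ C △ A ∥ ≡ m → m + (k + u) ≡ k + v
  balance {m} ∥C△A∥≡m = trans (cong₂ _+_ (sym ∥C△A∥≡m) (sym (∣p∣-split C A))) (trans on-geodesic ∣A∣≡)
  ∣∁[C△A]∣≡ : ∣ ∁ (C △ A) ∣ ≡ k + r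
  ∣∁[C△A]∣≡ = trans (cong ∣_∣ (sym (△-∁ʳ C A))) (trans (∣p△q∣ C (∁ A)) (cong (λ W → ∣ C ∩ W ∣ + r) (¬-involutive A)))
  inside-or-outside : (∥ C △ A ∥ ≡ ∣ C △ A ∣) ⊎ (∥ C △ A ∥ ≡ ∣ ∁ (C △ A) ∣) →
    Σ[ A' ∈ Subset (2 * D) ] A' ≈ₛ A × ∣ A' ∣ ≤ D × C ⊆ᶜ A'
  inside-or-outside (inj₁ ∥∥≡∣∣) = A , inj₁ refl , A≤D ,
    no-points-outside k u v (balance (trans ∥∥≡∣∣ (∣p△q∣ C A)))
  inside-or-outside (inj₂ ∥∥≡∣∁∣) = ∁ A , inj₂ refl , ≤-reflexive ∣∁A∣≡D ,
    trans (cong (λ W → ∣ C ∩ W ∣) (¬-involutive A)) (proj₁ outside)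
    where
    outside = no-points-inside k u v r (balance (trans ∥∥≡∣∁∣ ∣∁[C△A]∣≡))
      (trans (cong₂ _+_ (sym (∣p∣-split C A)) (sym (∣p∣-split (∁ C) A))) (∣w∣+∣∁w∣≡D+D {D} C))
      (subst (_≤ D) ∣A∣≡ A≤D)
    ∣∁A∣≡D : ∣ ∁ A ∣ ≡ D
    ∣∁A∣≡D = +-cancelˡ-≡ D ∣ ∁ A ∣ D
      (trans (cong (_+ ∣ ∁ A ∣) (sym (trans ∣A∣≡ (proj₂ outside)))) (∣w∣+∣∁w∣≡D+D {D} A))

dist-seen-from : ∀ {D} (x w v : X D) → dist w v ≡ ∥ (part x △ part w) △ (part x △ part v) ∥
dist-seen-from x w v = trans (dist≡∥△∥ w v) (cong ∥_∥ (sym (begin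
  (part x △ part w) △ (part x △ part v) ≡⟨ cong₂ _△_ (⊕-comm (part x) (part w)) (⊕-comm (part x) (part v)) ⟩
  (part w △ part x) △ (part v △ part x) ≡⟨ △-translate (part w) (part v) (part x) ⟩
  part w △ part v                       ∎)))
  where open ≡-Reasoning

common-geodesic-bound : ∀ {D} (x y z w : X D) → Between x w y → Between x w z → dist x w ≤ t3 x y z
common-geodesic-bound {D} x y z w w-on-xy w-on-xz = begin
  dist x w                           ≡⟨ ∣C∣≡ ⟨
  ∣ C ∣                              ≤⟨ ⊆ᶜ-∩ C A B C⊆A C⊆B ⟩
  ∣ A ∩ B ∣                          ≤⟨ labelling-bound (labelling {x = x} {y} {z} A B (≈ₛ-trans A≈Δ (SmallRep.same (Δ-rep x y)))
                                          (≈ₛ-trans B≈Δ (SmallRep.same (Δ-rep x z))) A≤D B≤D) ⟩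
  t3 x y z                           ∎
  where
  open ≤-Reasoning
  smallerC = smaller (part x △ part w)
  C = proj₁ smallerC
  C≈ = proj₁ (proj₂ smallerC)
  ∣C∣≡ : ∣ C ∣ ≡ dist x w
  ∣C∣≡ = trans (proj₂ (proj₂ smallerC)) (sym (dist≡∥△∥ x w))
  on-geodesic : ∀ v → Between x w v → ∥ C △ Δ x v ∥ + ∣ C ∣ ≡ ∣ Δ x v ∣
  on-geodesic v w-on-xv = trans (cong₂ _+_ (trans ∥C△Δ∥≡ (sym (dist-seen-from x w v))) ∣C∣≡)
    (trans (+-comm (dist w v) (dist x w)) (trans w-on-xv (sym (∣Δ∣≡dist x v))))
    where
    ∥C△Δ∥≡ : ∥ C △ Δ x v ∥ ≡ ∥ (part x △ part w) △ (part x △ part v) ∥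
    ∥C△Δ∥≡ = ∥∥-≈ₛ (≈ₛ-trans (≈ₛ-△ˡ C (SmallRep.same (Δ-rep x v))) (≈ₛ-△ʳ (part x △ part v) C≈))
  sideA = switched-inside-side C (Δ x y) (SmallRep.small (Δ-rep x y)) (on-geodesic y w-on-xy)
  sideB = switched-inside-side C (Δ x z) (SmallRep.small (Δ-rep x z)) (on-geodesic z w-on-xz)
  A = proj₁ sideA
  A≈Δ = proj₁ (proj₂ sideA)
  A≤D = proj₁ (proj₂ (proj₂ sideA))
  C⊆A = proj₂ (proj₂ (proj₂ sideA))
  B = proj₁ sideB
  B≈Δ = proj₁ (proj₂ sideB)
  B≤D = proj₁ (proj₂ (proj₂ sideB))
  C⊆B = proj₂ (proj₂ (proj₂ sideB))

∩-△ˡ : (p q : Subset n) → (p ∩ q) △ p ≡ p ∩ ∁ q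
∩-△ˡ []          []          = refl
∩-△ˡ (true ∷ p)  (true ∷ q)  = cong (false ∷_) (∩-△ˡ p q)
∩-△ˡ (true ∷ p)  (false ∷ q) = cong (true ∷_) (∩-△ˡ p q)
∩-△ˡ (false ∷ p) (true ∷ q)  = cong (false ∷_) (∩-△ˡ p q)
∩-△ˡ (false ∷ p) (false ∷ q) = cong (false ∷_) (∩-△ˡ p q)

∩-△ʳ : (p q : Subset n) → (p ∩ q) △ q ≡ ∁ p ∩ q
∩-△ʳ p q = trans (cong (_△ q) (∩-comm p q)) (trans (∩-△ˡ q p) (∩-comm q (∁ p)))

-- Switching the points of A ∩ B for an optimal labelling (A, B) gives a
-- vertex at distance t from x lying on geodesics to y and to z.
common-geodesic-witness : ∀ {D} (x y z : X D) →
  Σ[ w ∈ X D ] dist x w ≡ t3 x y z × Between x w y × Between x w z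
common-geodesic-witness {D} x y z = move x (A ∩ B) , trans dist-x-w ∣A∩B∣≡t ,
  between y A (Labelling.first≈ L) (Labelling.first≤D L) (∩-△ˡ A B) (sym (∣p∣-split A B)) (first-size L) ,
  between z B (Labelling.second≈ L) (Labelling.second≤D L) (∩-△ʳ A B)
    (sym (∣q∣-split A B))
    (second-size L)
  where
  optimal = optimal-labelling x y z
  L = proj₁ optimal
  ∣A∩B∣≡t = proj₂ optimal
  A = Labelling.first L
  B = Labelling.second L
  dist-x-w : dist x (move x (A ∩ B)) ≡ ∣ A ∩ B ∣
  dist-x-w = trans (dist-from-move x (A ∩ B)) (∥w∥≡∣w∣ {D} (A ∩ B) (≤-trans (∣p∩q∣≤∣p∣ A B) (Labelling.first≤D L)))
  between : ∀ v S → S ≈ₛ part x △ part v → ∣ S ∣ ≤ D → ∀ {rest} → (A ∩ B) △ S ≡ rest →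
    ∣ A ∩ B ∣ + ∣ rest ∣ ≡ ∣ S ∣ → ∣ S ∣ ≡ dist x v → Between x (move x (A ∩ B)) v
  between v S S≈ S≤D {rest} rest≡ sizes ∣S∣≡ = begin
    dist x (move x (A ∩ B)) + dist (move x (A ∩ B)) v  ≡⟨ cong₂ _+_ dist-x-w dist-w-v ⟩
    ∣ A ∩ B ∣ + ∣ rest ∣                               ≡⟨ sizes ⟩
    ∣ S ∣                                              ≡⟨ ∣S∣≡ ⟩
    dist x v                                           ∎
    where
    open ≡-Reasoning
    dist-w-v : dist (move x (A ∩ B)) v ≡ ∣ rest ∣
    dist-w-v = trans (dist-move x (A ∩ B) v) (trans (∥∥-≈ₛ (≈ₛ-△ˡ (A ∩ B) (≈ₛ-sym S≈)))
      (trans (cong ∥_∥ rest≡) (∥w∥≡∣w∣ {D} rest (≤-trans (m≤n+m ∣ rest ∣ ∣ A ∩ B ∣) (≤-trans (≤-reflexive sizes) S≤D)))))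

-- Isometries can only increase t, since they map common geodesics to
-- common geodesics.
isometry-t3 : ∀ {D} (h : X D → X D) → (∀ u v → dist (h u) (h v) ≡ dist u v) →
  ∀ x y z → t3 x y z ≤ t3 (h x) (h y) (h z)
isometry-t3 h isometry x y z =
  subst (_≤ t3 (h x) (h y) (h z)) (trans (isometry x w) dist-x-w≡t)
    (common-geodesic-bound (h x) (h y) (h z) (h w) (image w-on-xy) (image w-on-xz))
  where
  witness = common-geodesic-witness x y z
  w = proj₁ witness
  dist-x-w≡t = proj₁ (proj₂ witness)
  w-on-xy = proj₁ (proj₂ (proj₂ witness))
  w-on-xz = proj₂ (proj₂ (proj₂ witness))
  image : ∀ {v} → Between x w v → Between (h x) (h w) (h v)
  image {v} w-on-xv = trans (cong₂ _+_ (isometry x w) (isometry w v)) (trans w-on-xv (sym (isometry x v)))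

aut-preserves-dist3 : ∀ {D} → 1 ≤ D → (f : X D → X D) → IsAut f →
  ∀ x y z → dist3 (f x) (f y) (f z) ≡ dist3 x y z
aut-preserves-dist3 D≥1 f f-aut x y z =
  cong₂ _,_ (isometric x y) (cong₂ _,_ (isometric x z) (≤-antisym t-down t-up))
  where
  open Automorphism f f-aut
  isometric = preserves-dist D≥1
  inverse-isometric : ∀ u v → dist (inverse u) (inverse v) ≡ dist u v
  inverse-isometric u v = trans (sym (isometric (inverse u) (inverse v))) (cong₂ dist (f∘inverse u) (f∘inverse v))
  t-up : t3 x y z ≤ t3 (f x) (f y) (f z)
  t-up = isometry-t3 f isometric x y z
  t-down : t3 (f x) (f y) (f z) ≤ t3 x y z
  t-down = subst (t3 (f x) (f y) (f z) ≤_)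
    (cong₂ (λ u vw → t3 u (proj₁ vw) (proj₂ vw)) (inverse∘f x) (cong₂ _,_ (inverse∘f y) (inverse∘f z)))
    (isometry-t3 inverse inverse-isometric (f x) (f y) (f z))

orbit-invariant : ∀ {D} → 1 ≤ D → (a b : Triple D) → SameOrbit a b → dist3T a ≡ dist3T b
orbit-invariant D≥1 (x , y , z) _ ((f , f-aut) , refl) = sym (aut-preserves-dist3 D≥1 f f-aut x y z)

permute : Permutation n n → Subset n → Subset n
permute π v = tabulate (λ k → lookup v (π ⟨$⟩ʳ k))

lookup-permute : (π : Permutation n n) (v : Subset n) (k : Fin n) → lookup (permute π v) k ≡ lookup v (π ⟨$⟩ʳ k)
lookup-permute π v k = lookup∘tabulate _ k

subset-ext : (u v : Subset n) → (∀ k → lookup u k ≡ lookup v k) → u ≡ v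
subset-ext u v same = trans (sym (tabulate∘lookup u)) (trans (tabulate-cong same) (tabulate∘lookup v))

permute-zipWith : (π : Permutation n n) (f : Bool → Bool → Bool) (u v : Subset n) →
  permute π (zipWith f u v) ≡ zipWith f (permute π u) (permute π v)
permute-zipWith π f u v = subset-ext _ _ λ k → begin
  lookup (permute π (zipWith f u v)) k                   ≡⟨ lookup-permute π (zipWith f u v) k ⟩
  lookup (zipWith f u v) (π ⟨$⟩ʳ k)                      ≡⟨ lookup-zipWith f (π ⟨$⟩ʳ k) u v ⟩
  f (lookup u (π ⟨$⟩ʳ k)) (lookup v (π ⟨$⟩ʳ k))          ≡⟨ cong₂ f (lookup-permute π u k) (lookup-permute π v k) ⟨
  f (lookup (permute π u) k) (lookup (permute π v) k)    ≡⟨ lookup-zipWith f k (permute π u) (permute π v) ⟨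
  lookup (zipWith f (permute π u) (permute π v)) k       ∎
  where open ≡-Reasoning

permute-∁ : (π : Permutation n n) (u : Subset n) → permute π (∁ u) ≡ ∁ (permute π u)
permute-∁ π u = subset-ext _ _ λ k → begin
  lookup (permute π (∁ u)) k          ≡⟨ lookup-permute π (∁ u) k ⟩
  lookup (map not u) (π ⟨$⟩ʳ k)       ≡⟨ lookup-map (π ⟨$⟩ʳ k) not u ⟩
  not (lookup u (π ⟨$⟩ʳ k))           ≡⟨ cong not (lookup-permute π u k) ⟨
  not (lookup (permute π u) k)        ≡⟨ lookup-map k not (permute π u) ⟨
  lookup (∁ (permute π u)) k          ∎
  where open ≡-Reasoning

permute-∩ : (π : Permutation n n) (u v : Subset n) → permute π (u ∩ v) ≡ permute π u ∩ permute π v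
permute-∩ π = permute-zipWith π _∧_

permute-△ : (π : Permutation n n) (u v : Subset n) → permute π (u △ v) ≡ permute π u △ permute π v
permute-△ π u v = begin
  permute π (u △ v)                          ≡⟨ cong (permute π) (△-def u v) ⟩
  permute π ((u ∪ v) ∩ ∁ (u ∩ v))            ≡⟨ permute-∩ π (u ∪ v) (∁ (u ∩ v)) ⟩
  permute π (u ∪ v) ∩ permute π (∁ (u ∩ v))  ≡⟨ cong₂ _∩_ (permute-zipWith π _∨_ u v)
                                                  (trans (permute-∁ π (u ∩ v)) (cong ∁ (permute-∩ π u v))) ⟩
  (u' ∪ v') ∩ ∁ (u' ∩ v')                    ≡⟨ △-def u' v' ⟨
  u' △ v'                                    ∎
  where
  open ≡-Reasoning
  u' = permute π u
  v' = permute π v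

permute-inverse : (π : Permutation n n) (v : Subset n) → permute (flip π) (permute π v) ≡ v
permute-inverse π v = subset-ext _ _ λ k →
  trans (lookup-permute (flip π) (permute π v) k) (trans (lookup-permute π v (flip π ⟨$⟩ʳ k)) (cong (lookup v) (inverseʳ π)))

permute-inverse′ : (π : Permutation n n) (v : Subset n) → permute π (permute (flip π) v) ≡ v
permute-inverse′ π v = subset-ext _ _ λ k →
  trans (lookup-permute π (permute (flip π) v) k) (trans (lookup-permute (flip π) v (π ⟨$⟩ʳ k)) (cong (lookup v) (inverseˡ π)))

permute-∘ : (ρ τ : Permutation n n) (v : Subset n) → permute (ρ ∘ₚ τ) v ≡ permute ρ (permute τ v)
permute-∘ ρ τ v = subset-ext _ _ λ k →
  trans (lookup-permute (ρ ∘ₚ τ) v k) (sym (trans (lookup-permute ρ (permute τ v) k) (lookup-permute τ v (ρ ⟨$⟩ʳ k))))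

indicator : Bool → ℕ
indicator true  = 1
indicator false = 0

-- the size of a subset as a sum over its points, which permutations rearrange
∣v∣≡sum : (v : Subset n) → ∣ v ∣ ≡ sum (λ k → indicator (lookup v k))
∣v∣≡sum []          = refl
∣v∣≡sum (true ∷ v)  = cong suc (∣v∣≡sum v)
∣v∣≡sum (false ∷ v) = ∣v∣≡sum v

∣permute∣ : (π : Permutation n n) (v : Subset n) → ∣ permute π v ∣ ≡ ∣ v ∣
∣permute∣ π v = trans (∣v∣≡sum (permute π v)) (trans (sum-cong-≗ (λ k → cong indicator (lookup-permute π v k)))
  (trans (sym (sum-permute (λ k → indicator (lookup v k)) π)) (sym (∣v∣≡sum v))))

∥permute∥ : (π : Permutation n n) (w : Subset n) → ∥ permute π w ∥ ≡ ∥ w ∥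
∥permute∥ π w = cong₂ _⊓_ (∣permute∣ π w) (trans (cong ∣_∣ (sym (permute-∁ π w))) (∣permute∣ π (∁ w)))

side-permute : ∀ s (π : Permutation n n) (U : Subset n) → side s (permute π U) ≡ permute π (side s U)
side-permute true  π U = refl
side-permute false π U = sym (permute-∁ π U)

profile-permute : (π : Permutation n n) (A B : Subset n) → profile (permute π A) (permute π B) ≡ profile A B
profile-permute π A B =
  cong₂ _,_ (cell true true) (cong₂ _,_ (cell true false) (cong₂ _,_ (cell false true) (cell false false)))
  where
  cell : ∀ s₁ s₂ → ∣ side s₁ (permute π A) ∩ side s₂ (permute π B) ∣ ≡ ∣ side s₁ A ∩ side s₂ B ∣
  cell s₁ s₂ = trans (cong₂ (λ U V → ∣ U ∩ V ∣) (side-permute s₁ π A) (side-permute s₂ π B))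
    (trans (cong ∣_∣ (sym (permute-∩ π (side s₁ A) (side s₂ B)))) (∣permute∣ π (side s₁ A ∩ side s₂ B)))

bump : Bool → Bool → Profile → Profile
bump true  true  (a , b , c , e) = suc a , b , c , e
bump true  false (a , b , c , e) = a , suc b , c , e
bump false true  (a , b , c , e) = a , b , suc c , e
bump false false (a , b , c , e) = a , b , c , suc e

profile-∷ : ∀ α β (A B : Subset n) → profile (α ∷ A) (β ∷ B) ≡ bump α β (profile A B)
profile-∷ true  true  A B = refl
profile-∷ true  false A B = refl
profile-∷ false true  A B = refl
profile-∷ false false A B = refl

bump-injective : ∀ α β {q q'} → bump α β q ≡ bump α β q' → q ≡ q'
bump-injective true  true  {_ , _ , _ , _} {_ , _ , _ , _} refl = refl
bump-injective true  false {_ , _ , _ , _} {_ , _ , _ , _} refl = refl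
bump-injective false true  {_ , _ , _ , _} {_ , _ , _ , _} refl = refl
bump-injective false false {_ , _ , _ , _} {_ , _ , _ , _} refl = refl

entry-bump : ∀ α β q → entry α β (bump α β q) ≡ suc (entry α β q)
entry-bump true  true  _ = refl
entry-bump true  false _ = refl
entry-bump false true  _ = refl
entry-bump false false _ = refl

find-point : (v : Subset n) → 0 < ∣ v ∣ → Σ[ k ∈ Fin n ] lookup v k ≡ true
find-point (true ∷ v)  _        = zero , refl
find-point (false ∷ v) nonempty = let (k , k∈v) = find-point v nonempty in suc k , k∈v

∧-true : ∀ {x y} → x ∧ y ≡ true → x ≡ true × y ≡ true
∧-true {true} y≡true = refl , y≡true

side-true : ∀ α (A : Subset n) k → lookup (side α A) k ≡ true → lookup A k ≡ α
side-true true  A k k∈A  = k∈A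
side-true false A k k∈∁A with lookup A k | trans (sym (lookup-map k not A)) k∈∁A
... | false | _ = refl

cell-membership : ∀ α β (A B : Subset n) k → lookup (side α A ∩ side β B) k ≡ true →
  lookup A k ≡ α × lookup B k ≡ β
cell-membership α β A B k k∈cell =
  let (k∈A , k∈B) = ∧-true (trans (sym (lookup-zipWith _∧_ k (side α A) (side β B))) k∈cell)
  in side-true α A k k∈A , side-true β B k k∈B

-- Two pairs of subsets with the same profile are related by a permutation
-- of the points: move a point of the right cell to the front and recurse.
align : ∀ n (A B A₀ B₀ : Subset n) → profile A B ≡ profile A₀ B₀ →
  Σ[ π ∈ Permutation n n ] permute π A ≡ A₀ × permute π B ≡ B₀
align zero [] [] [] [] _ = idₚ , refl , refl
align (suc n) A B (α ∷ A₀) (β ∷ B₀) same = π , A-aligned , B-aligned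
  where
  profile≡ : profile A B ≡ bump α β (profile A₀ B₀)
  profile≡ = trans same (profile-∷ α β A₀ B₀)
  nonempty : 0 < ∣ side α A ∩ side β B ∣
  nonempty = subst (0 <_) (sym (trans (entry-profile α β A B) (trans (cong (entry α β) profile≡) (entry-bump α β _)))) (s≤s z≤n)
  point = find-point (side α A ∩ side β B) nonempty
  k = proj₁ point
  k-membership = cell-membership α β A B k (proj₂ point)
  τ : Permutation (suc n) (suc n)
  τ = transpose zero k
  A' = tail (permute τ A)
  B' = tail (permute τ B)
  A-front : permute τ A ≡ α ∷ A'
  A-front = cong (_∷ A') (proj₁ k-membership)
  B-front : permute τ B ≡ β ∷ B'
  B-front = cong (_∷ B') (proj₂ k-membership)
  rest : profile A' B' ≡ profile A₀ B₀
  rest = bump-injective α β (trans (sym (profile-∷ α β A' B'))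
    (trans (cong₂ profile (sym A-front) (sym B-front)) (trans (profile-permute τ A B) profile≡)))
  aligned = align n A' B' A₀ B₀ rest
  π = lift₀ (proj₁ aligned) ∘ₚ τ
  A-aligned : permute π A ≡ α ∷ A₀
  A-aligned = trans (permute-∘ (lift₀ (proj₁ aligned)) τ A)
    (trans (cong (permute (lift₀ (proj₁ aligned))) A-front) (cong (α ∷_) (proj₁ (proj₂ aligned))))
  B-aligned : permute π B ≡ β ∷ B₀
  B-aligned = trans (permute-∘ (lift₀ (proj₁ aligned)) τ B)
    (trans (cong (permute (lift₀ (proj₁ aligned))) B-front) (cong (β ∷_) (proj₂ (proj₂ aligned))))

permute-⊥ : (π : Permutation n n) → permute π ⊥ ≡ ⊥
permute-⊥ π = subset-ext _ _ λ k →
  trans (lookup-permute π ⊥ k) (trans (lookup-replicate (π ⟨$⟩ʳ k) false) (sym (lookup-replicate k false)))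

permute-≈ₛ : (π : Permutation n n) {p q : Subset n} → p ≈ₛ q → permute π p ≈ₛ permute π q
permute-≈ₛ π (inj₁ refl) = inj₁ refl
permute-≈ₛ π {q = q} (inj₂ refl) = inj₂ (permute-∁ π q)

affine : Permutation n n → Subset n → Subset n → Subset n → Subset n
affine π r₁ r₂ p = permute π (p △ r₁) △ r₂

affine-△ : (π : Permutation n n) (r₁ r₂ p q : Subset n) → affine π r₁ r₂ p △ affine π r₁ r₂ q ≡ permute π (p △ q)
affine-△ π r₁ r₂ p q = begin
  (permute π (p △ r₁) △ r₂) △ (permute π (q △ r₁) △ r₂) ≡⟨ △-translate _ _ r₂ ⟩
  permute π (p △ r₁) △ permute π (q △ r₁)               ≡⟨ permute-△ π (p △ r₁) (q △ r₁) ⟨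
  permute π ((p △ r₁) △ (q △ r₁))                       ≡⟨ cong (permute π) (△-translate p q r₁) ⟩
  permute π (p △ q)                                     ∎
  where open ≡-Reasoning

affine-≈ₛ : (π : Permutation n n) (r₁ r₂ : Subset n) {p q : Subset n} → p ≈ₛ q → affine π r₁ r₂ p ≈ₛ affine π r₁ r₂ q
affine-≈ₛ π r₁ r₂ p≈q = ≈ₛ-△ʳ r₂ (permute-≈ₛ π (≈ₛ-△ʳ r₁ p≈q))

affine-inverse : (π π' : Permutation n n) → (∀ w → permute π' (permute π w) ≡ w) →
  (r₁ r₂ p : Subset n) → affine π' r₂ r₁ (affine π r₁ r₂ p) ≡ p
affine-inverse π π' π'∘π r₁ r₂ p = begin
  permute π' ((permute π (p △ r₁) △ r₂) △ r₂) △ r₁ ≡⟨ cong (λ w → permute π' w △ r₁) (△-cancelʳ (permute π (p △ r₁)) r₂) ⟩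
  permute π' (permute π (p △ r₁)) △ r₁            ≡⟨ cong (_△ r₁) (π'∘π (p △ r₁)) ⟩
  (p △ r₁) △ r₁                                   ≡⟨ △-cancelʳ p r₁ ⟩
  p                                               ∎
  where open ≡-Reasoning

toVertex-≈ₛ : ∀ {D} {p : Subset (2 * D)} (v : X D) → p ≈ₛ part v → toVertex p ≡ v
toVertex-≈ₛ {p = p} v p≈v = vertex-≈ₛ (toVertex p) v (≈ₛ-trans (canonical-≈ₛ p) p≈v)

induced : ∀ {D} → Permutation (2 * D) (2 * D) → Subset (2 * D) → Subset (2 * D) → X D → X D
induced π r₁ r₂ v = toVertex (affine π r₁ r₂ (part v))

induced-isometry : ∀ {D} (π : Permutation (2 * D) (2 * D)) (r₁ r₂ : Subset (2 * D)) (u v : X D) →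
  dist (induced π r₁ r₂ u) (induced π r₁ r₂ v) ≡ dist u v
induced-isometry π r₁ r₂ u v = begin
  dist (induced π r₁ r₂ u) (induced π r₁ r₂ v)
    ≡⟨ dist-≈ₛ (induced π r₁ r₂ u) (induced π r₁ r₂ v) (canonical-≈ₛ (affine π r₁ r₂ (part u))) (canonical-≈ₛ (affine π r₁ r₂ (part v))) ⟩
  ∥ affine π r₁ r₂ (part u) △ affine π r₁ r₂ (part v) ∥ ≡⟨ cong ∥_∥ (affine-△ π r₁ r₂ (part u) (part v)) ⟩
  ∥ permute π (part u △ part v) ∥                       ≡⟨ ∥permute∥ π (part u △ part v) ⟩
  ∥ part u △ part v ∥                                   ≡⟨ dist≡∥△∥ u v ⟨
  dist u v                                              ∎
  where open ≡-Reasoning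

induced-inverse : ∀ {D} (π π' : Permutation (2 * D) (2 * D)) → (∀ w → permute π' (permute π w) ≡ w) →
  (r₁ r₂ : Subset (2 * D)) (v : X D) → induced π' r₂ r₁ (induced π r₁ r₂ v) ≡ v
induced-inverse π π' π'∘π r₁ r₂ v = toVertex-≈ₛ v (≈ₛ-trans (affine-≈ₛ π' r₂ r₁ (canonical-≈ₛ (affine π r₁ r₂ (part v))))
  (inj₁ (affine-inverse π π' π'∘π r₁ r₂ (part v))))

induced-isAut : ∀ {D} (π : Permutation (2 * D) (2 * D)) (r₁ r₂ : Subset (2 * D)) → IsAut (induced {D} π r₁ r₂)
induced-isAut {D} π r₁ r₂ = (injective , surjective) ,
  λ u v → mk⇔ (trans (induced-isometry π r₁ r₂ u v)) (trans (sym (induced-isometry π r₁ r₂ u v)))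
  where
  back = induced {D} (flip π) r₂ r₁
  injective : ∀ {u v} → induced {D} π r₁ r₂ u ≡ induced π r₁ r₂ v → u ≡ v
  injective {u} {v} same = trans (sym (induced-inverse π (flip π) (permute-inverse π) r₁ r₂ u))
    (trans (cong back same) (induced-inverse π (flip π) (permute-inverse π) r₁ r₂ v))
  surjective : ∀ y → ∃ λ v → ∀ {u} → u ≡ v → induced π r₁ r₂ u ≡ y
  surjective y = back y , λ { refl → induced-inverse (flip π) π (permute-inverse′ π) r₂ r₁ y }

induced-sends : ∀ {D} (π : Permutation (2 * D) (2 * D)) (x x' v v' : X D) {S S' : Subset (2 * D)} →
  S ≈ₛ part x △ part v → permute π S ≡ S' → S' ≈ₛ part x' △ part v' → induced π (part x) (part x') v ≡ v'
induced-sends π x x' v v' S≈ πS≡S' S'≈ = toVertex-≈ₛ v'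
  (≈ₛ-trans (≈ₛ-△ʳ (part x') (≈ₛ-trans (permute-≈ₛ π (≈ₛ-trans (inj₁ (⊕-comm (part v) (part x))) (≈ₛ-sym S≈)))
    (≈ₛ-trans (inj₁ πS≡S') S'≈)))
  (inj₁ (trans (cong (_△ part x') (⊕-comm (part x') (part v'))) (△-cancelʳ (part v') (part x')))))

-- Optimal labellings of both triples have the same profile, so a permutation
-- of the points aligns them, and the automorphism it induces (translating
-- x to x') carries the first triple onto the second.
same-shape-same-orbit : ∀ {D} (a b : Triple D) → dist3T a ≡ dist3T b → SameOrbit a b
same-shape-same-orbit {D} (x , y , z) (x' , y' , z') same =
  (induced {D} π (part x) (part x') , induced-isAut π (part x) (part x')) ,
  cong₂ _,_ (induced-sends π x x' x x' (self x) (permute-⊥ π) (self x'))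
    (cong₂ _,_ (induced-sends π x x' y y' (Labelling.first≈ L) (proj₁ (proj₂ aligned)) (Labelling.first≈ L'))
               (induced-sends π x x' z z' (Labelling.second≈ L) (proj₂ (proj₂ aligned)) (Labelling.second≈ L')))
  where
  optimal  = optimal-labelling x y z
  optimal' = optimal-labelling x' y' z'
  L  = proj₁ optimal
  L' = proj₁ optimal'
  A  = Labelling.first L
  B  = Labelling.second L
  A' = Labelling.first L'
  B' = Labelling.second L'
  profiles : profile A B ≡ profile A' B'
  profiles = profile-determined A B A' B'
    (trans (first-size L) (trans (cong proj₁ same) (sym (first-size L'))))
    (trans (second-size L) (trans (cong (λ d → proj₁ (proj₂ d)) same) (sym (second-size L'))))
    (trans (proj₂ optimal) (trans (cong (λ d → proj₂ (proj₂ d)) same) (sym (proj₂ optimal'))))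
  aligned = align (2 * D) A B A' B' profiles
  π : Permutation (2 * D) (2 * D)
  π = proj₁ aligned
  self : ∀ v → ⊥ ≈ₛ part v △ part v
  self v = inj₁ (sym (⊕-inverseʳ (part v)))

proposition3p2 : (D : ℕ) → 3 ≤ D →
    ((a : Triple D) → InI D (dist3T a))
    × ((ijt : ℕ × ℕ × ℕ) → InI D ijt → Σ[ a ∈ Triple D ] dist3T a ≡ ijt)
    × ((a b : Triple D) → (dist3T a ≡ dist3T b) ⇔ SameOrbit a b)
proposition3p2 D D≥3 =
  dist3-InI D D≥3 ,
  dist3-onto D D≥3 ,
  λ a b → mk⇔ (same-shape-same-orbit a b) (orbit-invariant (≤-trans (s≤s z≤n) D≥3) a b)
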